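{- Let $p>2$ be a prime and $n=2p$. Then the number of equivalence classes of $n$-polygons with $p$ axes is $$|P_p(2p)|=\left(\frac{n-2}{4}\right)^2.$$
   Context: Fix $n\ge 3$ and the vertices $v_k=e^{2\pi i k/n}$ on the unit circle. An $n$-polygon is a Hamiltonian cycle through these vertices, i.e. a closed path $v_{\sigma_1}\cdots v_{\sigma_n}v_{\sigma_1}$ of straight segments with $(\sigma_1,\ldots,\sigma_n)$ an ordering of $0,\ldots,n-1$. Two $n$-polygons are equivalent if one is obtained from the other by a rotation about the center. An $n$-polygon with $m$ axes is one with exactly $m$ axes of reflection symmetry; $|P_m(n)|$ denotes the number of equivalence classes of such polygons. -}

module Defs where

open import Data.Nat using (ℕ; zero; suc; _+_; _∸_)
open import Data.Nat.DivMod using (_mod_)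
open import Data.Fin using (Fin; toℕ)
open import Data.Product using (Σ; ∃-syntax; _×_; _,_; proj₁)
open import Data.Sum using (_⊎_)
open import Data.List using (List; length)
open import Data.List.Relation.Unary.Any using (Any)
open import Data.List.Relation.Unary.All using (All)
open import Data.List.Relation.Unary.AllPairs using (AllPairs)
open import Data.List.Relation.Unary.Unique.Propositional using (Unique)
open import Data.List.Membership.Propositional using (_∈_)
open import Function.Bundles using (_⇔_)
open import Function.Definitions using (Injective)
open import Relation.Binary.PropositionalEquality using (_≡_)
open import Relation.Nullary using (¬_)

-- Vertices v_k = e^{2πik/n} are identified with k ∈ Fin n.

_⊕_ : ∀ {n} → Fin n → ℕ → Fin n
_⊕_ {suc m} a k = (toℕ a + k) mod (suc m)

-- the reflection a ↦ c − a (mod n); these are the n reflections of the regular n-gon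
reflect : ∀ {n} → Fin n → Fin n → Fin n
reflect {suc m} c a = (toℕ c + (suc m ∸ toℕ a)) mod (suc m)

-- an ordering (σ_1,…,σ_n) of 0,…,n-1 (indexed from 0); it determines the
-- closed path v_{σ_0} v_{σ_1} ⋯ v_{σ_{n-1}} v_{σ_0}
Ordering : ℕ → Set
Ordering n = Σ (Fin n → Fin n) (Injective _≡_ _≡_)

Adj : ∀ {n} → (Fin n → Fin n) → Fin n → Fin n → Set
Adj σ a b = ∃[ i ] ((σ i ≡ a × σ (i ⊕ 1) ≡ b) ⊎ (σ i ≡ b × σ (i ⊕ 1) ≡ a))

IsAxis : ∀ {n} → Ordering n → Fin n → Set
IsAxis (σ , _) c = ∀ a b → Adj σ a b ⇔ Adj σ (reflect c a) (reflect c b)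

HasAxes : ∀ {n} → ℕ → Ordering n → Set
HasAxes {n} m P =
  Σ (List (Fin n)) λ cs → Unique cs × length cs ≡ m × (∀ c → c ∈ cs ⇔ IsAxis P c)

Equiv : ∀ {n} → Ordering n → Ordering n → Set
Equiv P Q = ∃[ k ] (∀ a b → Adj (proj₁ P) a b ⇔ Adj (proj₁ Q) (a ⊕ k) (b ⊕ k))

-- |P_m(n)| = k : there is a complete system of k pairwise inequivalent
-- representatives of the equivalence classes of n-polygons with exactly m axes
NumClasses : ℕ → ℕ → ℕ → Set
NumClasses n m k =
  Σ (List (Ordering n)) λ L →
      length L ≡ k
    × All (HasAxes m) L
    × AllPairs (λ P Q → ¬ Equiv P Q) L
    × (∀ P → HasAxes m P → Any (Equiv P) L)

-- Work in ℤ/2pℤ. Composing the reflections x ↦ c − x and x ↦ d − x gives the rotation by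
-- c − d; among p ≥ 3 axes two have centres of the same parity, so the rotation by some 2e with
-- 0 < e < p is a symmetry, hence (e being invertible mod p) so is the rotation by 2. The rotation
-- by 1 is not, as it would make all 2p reflections axes. Invariance under the rotation by 2 makes
-- the polygon a zigzag: the neighbours b, c of 0 are odd (an even one would confine the polygon
-- to even vertices), every even x is joined to x + b and x + c, and b + c ≢ 0 (otherwise the
-- rotation by 1 would be a symmetry). Conversely, for odd b ≢ c with b + c ≢ 0 the zigzag is a
-- polygon whose axes are exactly the p odd reflections. An even rotation preserves {b, c} and an
-- odd one negates it, so writing {b, c} = {2i + 1, 2j + 1} the classes correspond to the pairs
-- i < j with i + j + 2 ≤ p, and there are q² of these when p = 2q + 1.
module Submission where

open import Data.Nat as ℕ using (ℕ; zero; suc; _≤_; _<_; s≤s; z≤n)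
import Data.Nat.Properties as ℕP
import Data.Nat.DivMod as ℕD
import Data.Nat.Tactic.RingSolver as ℕSolver
open import Data.Nat.Coprimality as Coprime using (coprime-Bézout; prime⇒coprime)
open import Data.Nat.Divisibility using (divides)
open import Data.Nat.GCD using (module Bézout)
open import Data.Nat.Primality using (Prime; prime⇒irreducible)
open import Data.Integer as ℤ using (ℤ; +_; -[1+_]; _+_; _*_; -_; _-_)
import Data.Integer.Properties as ℤP
import Data.Integer.DivMod as ℤD
open import Data.Integer.Tactic.RingSolver using (solve-∀; solve)
open import Data.Fin as F using (Fin; toℕ; fromℕ<)
import Data.Fin.Properties as FP
open import Data.Product as Prod using (Σ; ∃; _×_; _,_; proj₁; proj₂)
open import Data.Sum as Sum using (_⊎_; inj₁; inj₂)
open import Data.Empty using (⊥; ⊥-elim)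
open import Data.List using (List; []; _∷_; length; applyUpTo; _++_)
import Data.List.Properties as ListP
-- The constructors of All and AllPairs are opened only locally: overloading [] and _∷_ makes
-- the ring solver's variable lists very slow to elaborate.
open import Data.List.Relation.Unary.All as ListAll using (All)
import Data.List.Relation.Unary.All.Properties as AllP
open import Data.List.Relation.Unary.AllPairs using (AllPairs)
import Data.List.Relation.Unary.AllPairs.Properties as AllPairsP
open import Data.List.Relation.Unary.Any as Any using (Any; here; there)
open import Data.List.Relation.Unary.Unique.Propositional using (Unique)
open import Data.List.Membership.Propositional using (_∈_)
import Data.List.Membership.Propositional.Properties as MembershipP
import Data.List.Membership.Setoid.Properties as SetoidMembership
open import Function using (_∘_; id)
open import Function.Bundles using (_⇔_; mk⇔; Equivalence)
open import Function.Definitions using (Injective)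
open import Level using (0ℓ)
open import Relation.Binary.Bundles using (Setoid)
open import Relation.Binary.Definitions using (Tri; tri<; tri≈; tri>)
import Relation.Binary.Reasoning.Setoid as SetoidReasoning
open import Relation.Binary.PropositionalEquality
open import Relation.Nullary using (¬_; yes; no)
open import Defs

record Even (x : ℤ) : Set where
  constructor even
  field
    half : ℤ
    is-double : x ≡ half * + 2

record Odd (x : ℤ) : Set where
  constructor odd
  field
    suc-even : Even (+ 1 + x)

double-even : ∀ z → Even (z * + 2)
double-even z = even z refl

1-odd : Odd (+ 1)
1-odd = odd (even (+ 1) refl)

even⇒¬odd : ∀ {x} → Even x → ¬ Odd x
even⇒¬odd {x} (even q e) (odd (even r f)) = one≢double (r - q) (begin
  + 1                        ≡⟨ solve (x ∷ []) ⟩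
  (+ 1 + x) - x              ≡⟨ cong₂ _-_ f e ⟩
  r * + 2 - q * + 2          ≡⟨ solve (r ∷ q ∷ []) ⟩
  (r - q) * + 2              ∎)
  where
    open ≡-Reasoning
    one≢double : ∀ z → + 1 ≢ z * + 2
    one≢double (+ zero) ()
    one≢double (+ suc zero) ()
    one≢double (+ suc (suc n)) ()
    one≢double -[1+ n ] ()

parity : ∀ x → Even x ⊎ Odd x
parity x = split (x ℤ.%ℕ 2) (x ℤ./ℕ 2) (ℤD.n%ℕd<d x 2) (ℤD.a≡a%ℕn+[a/ℕn]*n x 2)
  where
    split : ∀ r q → r < 2 → x ≡ + r + q * + 2 → Even x ⊎ Odd x
    split 0 q _ x≡ = inj₁ (even q (trans x≡ (ℤP.+-identityˡ _)))
    split 1 q _ x≡ = inj₂ (odd (even (+ 1 + q) (begin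
      + 1 + x                ≡⟨ cong (λ z → + 1 + z) x≡ ⟩
      + 1 + (+ 1 + q * + 2)  ≡⟨ solve (q ∷ []) ⟩
      (+ 1 + q) * + 2        ∎)))
      where open ≡-Reasoning
    split (suc (suc r)) _ (s≤s (s≤s ())) _

even+even : ∀ {x y} → Even x → Even y → Even (x + y)
even+even (even q e) (even r f) = even (q + r) (trans (cong₂ _+_ e f) (sym (ℤP.*-distribʳ-+ (+ 2) q r)))

even+odd : ∀ {x y} → Even x → Odd y → Odd (x + y)
even+odd {x} {y} ex (odd ey) = odd (subst Even reassoc (even+even ex ey))
  where
    reassoc : x + (+ 1 + y) ≡ + 1 + (x + y)
    reassoc = solve (x ∷ y ∷ [])

odd+even : ∀ {x y} → Odd x → Even y → Odd (x + y)
odd+even {x} {y} ox ey = subst Odd (ℤP.+-comm y x) (even+odd ey ox)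

odd+odd : ∀ {x y} → Odd x → Odd y → Even (x + y)
odd+odd {x} {y} (odd (even q e)) (odd (even r f)) = even (q + r - + 1) (begin
  x + y                          ≡⟨ solve (x ∷ y ∷ []) ⟩
  (+ 1 + x) + (+ 1 + y) - + 2    ≡⟨ cong (_- + 2) (cong₂ _+_ e f) ⟩
  q * + 2 + r * + 2 - + 2        ≡⟨ solve (q ∷ r ∷ []) ⟩
  (q + r - + 1) * + 2            ∎)
  where open ≡-Reasoning

neg-even : ∀ {x} → Even x → Even (- x)
neg-even (even q e) = even (- q) (trans (cong -_ e) (ℤP.neg-distribˡ-* q (+ 2)))

neg-odd : ∀ {x} → Odd x → Odd (- x)
neg-odd {x} (odd e) = subst Odd shift (even+odd (neg-even e) 1-odd)
  where
    shift : - (+ 1 + x) + + 1 ≡ - x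
    shift = solve (x ∷ [])

even-even : ∀ {x y} → Even x → Even y → Even (x - y)
even-even ex ey = even+even ex (neg-even ey)

odd-odd : ∀ {x y} → Odd x → Odd y → Even (x - y)
odd-odd ox oy = odd+odd ox (neg-odd oy)

odd-even : ∀ {x y} → Odd x → Even y → Odd (x - y)
odd-even ox ey = odd+even ox (neg-even ey)

*-even : ∀ z {x} → Even x → Even (z * x)
*-even z (even q e) = even (z * q) (trans (cong (z *_) e) (sym (ℤP.*-assoc z q (+ 2))))

odd*odd : ∀ {x y} → Odd x → Odd y → Odd (x * y)
odd*odd {x} {y} (odd (even q e)) (odd (even r f)) = odd (even (q * r * + 2 - q - r + + 1) (begin
  + 1 + x * y                                        ≡⟨ solve (x ∷ y ∷ []) ⟩
  (+ 1 + x) * (+ 1 + y) - (+ 1 + x) - (+ 1 + y) + + 2 ≡⟨ cong₂ (λ a b → a * b - a - b + + 2) e f ⟩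
  q * + 2 * (r * + 2) - q * + 2 - r * + 2 + + 2      ≡⟨ solve (q ∷ r ∷ []) ⟩
  (q * r * + 2 - q - r + + 1) * + 2                  ∎))
  where open ≡-Reasoning

prime-odd : ∀ {p} → Prime p → p ≢ 2 → Odd (+ p)
prime-odd {p} pr p≢2 with parity (+ p)
... | inj₂ op = op
... | inj₁ (even q e) with prime⇒irreducible pr (divides ℤ.∣ q ∣ (trans (cong ℤ.∣_∣ e) (ℤP.abs-* q (+ 2))))
...   | inj₁ ()
...   | inj₂ 2≡p = ⊥-elim (p≢2 (sym 2≡p))

double : ℕ → ℕ
double zero = zero
double (suc m) = suc (suc (double m))

double≡+ : ∀ m → double m ≡ m ℕ.+ m
double≡+ zero = refl
double≡+ (suc m) = cong suc (trans (cong suc (double≡+ m)) (sym (ℕP.+-suc m m)))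

double-or-suc-double : ∀ n → ∃ λ m → n ≡ double m ⊎ n ≡ suc (double m)
double-or-suc-double zero = zero , inj₁ refl
double-or-suc-double (suc zero) = zero , inj₂ refl
double-or-suc-double (suc (suc n)) with m , n≡ ← double-or-suc-double n =
  suc m , Sum.map (cong (λ z → suc (suc z))) (cong (λ z → suc (suc z))) n≡

double-<-cancel : ∀ {m n} → double m < double n → m < n
double-<-cancel {zero} {suc n} _ = s≤s z≤n
double-<-cancel {suc m} {suc n} (s≤s (s≤s le)) = s≤s (double-<-cancel le)

suc-double-< : ∀ {m n} → m < n → suc (double m) < double n
suc-double-< {zero} {suc n} _ = s≤s (s≤s z≤n)
suc-double-< {suc m} {suc n} (s≤s le) = s≤s (s≤s (suc-double-< le))

double-injective : ∀ {m n} → double m ≡ double n → m ≡ n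
double-injective {zero} {zero} _ = refl
double-injective {suc m} {suc n} eq = cong suc (double-injective (ℕP.suc-injective (ℕP.suc-injective eq)))

double≡*2 : ∀ m → double m ≡ m ℕ.* 2
double≡*2 m = trans (double≡+ m) (trans (cong (m ℕ.+_) (sym (ℕP.+-identityʳ m))) (ℕP.*-comm 2 m))

+double≡*2 : ∀ m → + double m ≡ + m * + 2
+double≡*2 m = trans (cong +_ (double≡*2 m)) (ℤP.pos-* m 2)

suc-double-odd : ∀ m → Odd (+ suc (double m))
suc-double-odd m = subst Odd (trans (cong (λ z → + 1 + z) (sym (+double≡*2 m))) (sym (ℤP.pos-+ 1 (double m))))
                          (odd+even 1-odd (double-even (+ m)))

odd⇒suc-double : ∀ {n} → Odd (+ n) → ∃ λ q → n ≡ suc (double q)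
odd⇒suc-double {n} on with q , n≡ ← double-or-suc-double n = q , Sum.[ absurd , (λ e → e) ]′ n≡
  where
    absurd : n ≡ double q → n ≡ suc (double q)
    absurd n≡2q = ⊥-elim (even⇒¬odd (subst Even (sym (trans (cong +_ n≡2q) (+double≡*2 q))) (double-even (+ q))) on)

x-[x-y]≡y : ∀ x y → x - (x - y) ≡ y
x-[x-y]≡y = solve-∀

module Congruence (M : ℕ) where

  N : ℕ
  N = suc M

  infix 4 _≈_
  record _≈_ (x y : ℤ) : Set where
    constructor mk≈
    field
      quotient : ℤ
      difference : x - y ≡ quotient * + N

  ≈-refl : ∀ {x} → x ≈ x
  ≈-refl {x} = mk≈ (+ 0) (ℤP.+-inverseʳ x)

  ≈-reflexive : ∀ {x y} → x ≡ y → x ≈ y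
  ≈-reflexive refl = ≈-refl

  ≈-sym : ∀ {x y} → x ≈ y → y ≈ x
  ≈-sym {x} {y} (mk≈ q e) = mk≈ (- q) (begin
    y - x        ≡⟨ solve (x ∷ y ∷ []) ⟩
    - (x - y)    ≡⟨ cong -_ e ⟩
    - (q * + N)  ≡⟨ ℤP.neg-distribˡ-* q (+ N) ⟩
    - q * + N    ∎)
    where open ≡-Reasoning

  ≈-trans : ∀ {x y z} → x ≈ y → y ≈ z → x ≈ z
  ≈-trans {x} {y} {z} (mk≈ q e) (mk≈ r f) = mk≈ (q + r) (begin
    x - z                  ≡⟨ solve (x ∷ y ∷ z ∷ []) ⟩
    (x - y) + (y - z)      ≡⟨ cong₂ _+_ e f ⟩
    q * + N + r * + N      ≡⟨ ℤP.*-distribʳ-+ (+ N) q r ⟨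
    (q + r) * + N          ∎)
    where open ≡-Reasoning

  ≈-setoid : Setoid 0ℓ 0ℓ
  ≈-setoid = record
    { Carrier = ℤ
    ; _≈_ = _≈_
    ; isEquivalence = record { refl = ≈-refl ; sym = ≈-sym ; trans = ≈-trans }
    }

  module ≈-Reasoning = SetoidReasoning ≈-setoid

  +-cong : ∀ {x y x' y'} → x ≈ x' → y ≈ y' → x + y ≈ x' + y'
  +-cong {x} {y} {x'} {y'} (mk≈ q e) (mk≈ r f) = mk≈ (q + r) (begin
    (x + y) - (x' + y')    ≡⟨ solve (x ∷ y ∷ x' ∷ y' ∷ []) ⟩
    (x - x') + (y - y')    ≡⟨ cong₂ _+_ e f ⟩
    q * + N + r * + N      ≡⟨ ℤP.*-distribʳ-+ (+ N) q r ⟨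
    (q + r) * + N          ∎)
    where open ≡-Reasoning

  neg-cong : ∀ {x y} → x ≈ y → - x ≈ - y
  neg-cong {x} {y} (mk≈ q e) = mk≈ (- q) (begin
    - x - - y    ≡⟨ solve (x ∷ y ∷ []) ⟩
    - (x - y)    ≡⟨ cong -_ e ⟩
    - (q * + N)  ≡⟨ ℤP.neg-distribˡ-* q (+ N) ⟩
    - q * + N    ∎)
    where open ≡-Reasoning

  sub-cong : ∀ {x y x' y'} → x ≈ x' → y ≈ y' → x - y ≈ x' - y'
  sub-cong p q = +-cong p (neg-cong q)

  +-congˡ : ∀ z {x y} → x ≈ y → z + x ≈ z + y
  +-congˡ z = +-cong (≈-refl {z})

  +-congʳ : ∀ z {x y} → x ≈ y → x + z ≈ y + z
  +-congʳ z p = +-cong p (≈-refl {z})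

  +-cancelʳ : ∀ {c x y} → x + c ≈ y + c → x ≈ y
  +-cancelʳ {c} {x} {y} p = begin
    x              ≡⟨ solve (c ∷ x ∷ []) ⟩
    x + c - c      ≈⟨ +-congʳ (- c) p ⟩
    y + c - c      ≡⟨ solve (c ∷ y ∷ []) ⟨
    y              ∎
    where open ≈-Reasoning

  *-congˡ : ∀ z {x y} → x ≈ y → z * x ≈ z * y
  *-congˡ z {x} {y} (mk≈ q e) = mk≈ (z * q) (begin
    z * x - z * y    ≡⟨ solve (z ∷ x ∷ y ∷ []) ⟩
    z * (x - y)      ≡⟨ cong (z *_) e ⟩
    z * (q * + N)    ≡⟨ ℤP.*-assoc z q (+ N) ⟨
    z * q * + N      ∎)
    where open ≡-Reasoning

  +-cancelˡ : ∀ {c x y} → c + x ≈ c + y → x ≈ y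
  +-cancelˡ {c} {x} {y} p = begin
    x              ≡⟨ solve (c ∷ x ∷ []) ⟩
    - c + (c + x)  ≈⟨ +-congˡ (- c) p ⟩
    - c + (c + y)  ≡⟨ solve (c ∷ y ∷ []) ⟨
    y              ∎
    where open ≈-Reasoning

  difference≈0⇒≈ : ∀ {x y} → x - y ≈ + 0 → x ≈ y
  difference≈0⇒≈ {x} {y} d = begin
    x           ≡⟨ solve (x ∷ y ∷ []) ⟩
    x - y + y   ≈⟨ +-congʳ y d ⟩
    + 0 + y     ≡⟨ ℤP.+-identityˡ y ⟩
    y           ∎
    where open ≈-Reasoning

  +≈0⇒neg≈ : ∀ {x y} → x + y ≈ + 0 → - x ≈ y
  +≈0⇒neg≈ {x} {y} x+y≈0 = begin
    - x            ≡⟨ solve (x ∷ y ∷ []) ⟩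
    y - (x + y)    ≈⟨ sub-cong (≈-refl {y}) x+y≈0 ⟩
    y - + 0        ≡⟨ ℤP.+-identityʳ y ⟩
    y              ∎
    where open ≈-Reasoning

  ≈neg⇒+≈0 : ∀ {x y} → x ≈ - y → x + y ≈ + 0
  ≈neg⇒+≈0 {x} {y} x≈-y = ≈-trans (+-congʳ y x≈-y) (≈-reflexive (ℤP.+-inverseˡ y))

  +-multiple : ∀ x q → x + q * + N ≈ x
  +-multiple x q = mk≈ q (solve (x ∷ q ∷ []))

  N≈0 : + N ≈ + 0
  N≈0 = mk≈ (+ 1) (trans (ℤP.+-identityʳ (+ N)) (sym (ℤP.*-identityˡ (+ N))))

  private
    big-≢ : ∀ {m n} k → m < N → m ≢ suc k ℕ.* N ℕ.+ n
    big-≢ {m} {n} k m<N e = ℕP.<-irrefl refl (ℕP.<-≤-trans m<N (begin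
      N                      ≤⟨ ℕP.m≤m+n N (k ℕ.* N ℕ.+ n) ⟩
      N ℕ.+ (k ℕ.* N ℕ.+ n)  ≡⟨ ℕP.+-assoc N (k ℕ.* N) n ⟨
      suc k ℕ.* N ℕ.+ n      ≡⟨ e ⟨
      m                      ∎))
      where open ℕP.≤-Reasoning

    sub≡⇒≡+ : ∀ x y {z} → x - y ≡ z → x ≡ z + y
    sub≡⇒≡+ x y {z} e = begin
      x          ≡⟨ solve (x ∷ y ∷ []) ⟩
      x - y + y  ≡⟨ cong (_+ y) e ⟩
      z + y      ∎
      where open ≡-Reasoning

    multiple-lift : ∀ {m n} k → + m - + n ≡ + suc k * + N → m ≡ suc k ℕ.* N ℕ.+ n
    multiple-lift {m} {n} k e = ℤP.+-injective (trans (sub≡⇒≡+ (+ m) (+ n) e)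
      (trans (cong (_+ + n) (sym (ℤP.pos-* (suc k) N))) (sym (ℤP.pos-+ (suc k ℕ.* N) n))))

  ≈⇒≡-ℕ : ∀ {m n} → m < N → n < N → + m ≈ + n → m ≡ n
  ≈⇒≡-ℕ {m} {n} m< n< (mk≈ (+ zero) e) = ℤP.+-injective (trans (sub≡⇒≡+ (+ m) (+ n) e) (ℤP.+-identityˡ _))
  ≈⇒≡-ℕ {m} {n} m< n< (mk≈ (+ suc k) e) = ⊥-elim (big-≢ k m< (multiple-lift {m} {n} k e))
  ≈⇒≡-ℕ {m} {n} m< n< m≈n@(mk≈ -[1+ k ] _) =
    ⊥-elim (big-≢ k n< (multiple-lift {n} {m} k (_≈_.difference (≈-sym {+ m} {+ n} m≈n))))

  opaque
    ι : Fin N → ℤ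
    ι a = + toℕ a

    ι-def : ∀ a → ι a ≡ + toℕ a
    ι-def a = refl

    ι-injective : ∀ {a b} → ι a ≈ ι b → a ≡ b
    ι-injective {a} {b} p = FP.toℕ-injective (≈⇒≡-ℕ (FP.toℕ<n a) (FP.toℕ<n b) p)

    ⌊_⌋ : ℤ → Fin N
    ⌊ x ⌋ = fromℕ< (ℤD.n%ℕd<d x N)

    ι⌊⌋ : ∀ x → ι ⌊ x ⌋ ≈ x
    ι⌊⌋ x = ≈-sym (begin
      x                                    ≡⟨ ℤD.a≡a%ℕn+[a/ℕn]*n x N ⟩
      + (x ℤ.%ℕ N) + (x ℤ./ℕ N) * + N      ≈⟨ +-multiple _ (x ℤ./ℕ N) ⟩
      + (x ℤ.%ℕ N)                         ≡⟨ cong +_ (FP.toℕ-fromℕ< _) ⟨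
      ι ⌊ x ⌋                              ∎)
      where open ≈-Reasoning

  private
    %-≈ : ∀ m → + (m ℕ.% N) ≈ + m
    %-≈ m = ≈-sym (begin
      + m                                  ≡⟨ cong +_ (ℕD.m≡m%n+[m/n]*n m N) ⟩
      + (m ℕ.% N ℕ.+ m ℕ./ N ℕ.* N)        ≡⟨ ℤP.pos-+ (m ℕ.% N) _ ⟩
      + (m ℕ.% N) + + (m ℕ./ N ℕ.* N)      ≡⟨ cong (λ z → + (m ℕ.% N) + z) (ℤP.pos-* (m ℕ./ N) N) ⟩
      + (m ℕ.% N) + + (m ℕ./ N) * + N      ≈⟨ +-multiple _ (+ (m ℕ./ N)) ⟩
      + (m ℕ.% N)                          ∎)
      where open ≈-Reasoning

    ι-fromℕ%  : ∀ m → ι (fromℕ< (ℕD.m%n<n m N)) ≈ + m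
    ι-fromℕ% m = ≈-trans (≈-reflexive (trans (ι-def _) (cong +_ (FP.toℕ-fromℕ< _)))) (%-≈ m)

  ι-⊕ : ∀ a k → ι (a ⊕ k) ≈ ι a + + k
  ι-⊕ a k = begin
    ι (a ⊕ k)            ≈⟨ ι-fromℕ% (toℕ a ℕ.+ k) ⟩
    + (toℕ a ℕ.+ k)      ≡⟨ ℤP.pos-+ (toℕ a) k ⟩
    + toℕ a + + k        ≡⟨ cong (_+ + k) (ι-def a) ⟨
    ι a + + k            ∎
    where open ≈-Reasoning

  ι-reflect : ∀ c a → ι (reflect c a) ≈ ι c - ι a
  ι-reflect c a = begin
    ι (reflect c a)                  ≈⟨ ι-fromℕ% (toℕ c ℕ.+ (N ℕ.∸ toℕ a)) ⟩
    + (toℕ c ℕ.+ (N ℕ.∸ toℕ a))      ≡⟨ ℤP.pos-+ (toℕ c) (N ℕ.∸ toℕ a) ⟩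
    + toℕ c + + (N ℕ.∸ toℕ a)        ≡⟨ cong (λ z → + toℕ c + z) N∸a≡N-a ⟩
    + toℕ c + (+ N - + toℕ a)        ≈⟨ +-congˡ (+ toℕ c) (sub-cong N≈0 (≈-refl {+ toℕ a})) ⟩
    + toℕ c + (+ 0 - + toℕ a)        ≡⟨ cong (λ z → + toℕ c + z) (ℤP.+-identityˡ (- + toℕ a)) ⟩
    + toℕ c - + toℕ a                ≡⟨ cong₂ _-_ (ι-def c) (ι-def a) ⟨
    ι c - ι a                        ∎
    where
      open ≈-Reasoning
      N∸a≡N-a : + (N ℕ.∸ toℕ a) ≡ + N - + toℕ a
      N∸a≡N-a = trans (sym (ℤP.≤-⊖ (ℕP.<⇒≤ (FP.toℕ<n a)))) (sym (ℤP.m-n≡m⊖n N (toℕ a)))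

  ⌊⌋-cong : ∀ {x y} → x ≈ y → ⌊ x ⌋ ≡ ⌊ y ⌋
  ⌊⌋-cong {x} {y} p = ι-injective (≈-trans (ι⌊⌋ x) (≈-trans p (≈-sym (ι⌊⌋ y))))

  ⌊ι⌋ : ∀ a → ⌊ ι a ⌋ ≡ a
  ⌊ι⌋ a = ι-injective (ι⌊⌋ (ι a))

  ⌊⌋-injective : ∀ {x y} → ⌊ x ⌋ ≡ ⌊ y ⌋ → x ≈ y
  ⌊⌋-injective {x} {y} e = ≈-trans (≈-sym (ι⌊⌋ x)) (≈-trans (≈-reflexive (cong ι e)) (ι⌊⌋ y))

  ι-⊕-⊕ : ∀ i a b → ι ((i ⊕ a) ⊕ b) ≈ ι i + + (a ℕ.+ b)
  ι-⊕-⊕ i a b = begin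
    ι ((i ⊕ a) ⊕ b)     ≈⟨ ι-⊕ (i ⊕ a) b ⟩
    ι (i ⊕ a) + + b     ≈⟨ +-congʳ (+ b) (ι-⊕ i a) ⟩
    ι i + + a + + b     ≡⟨ ℤP.+-assoc (ι i) (+ a) (+ b) ⟩
    ι i + (+ a + + b)   ≡⟨ cong (λ z → ι i + z) (ℤP.pos-+ a b) ⟨
    ι i + + (a ℕ.+ b)   ∎
    where open ≈-Reasoning

  ⊕-N : ∀ i {a b} → a ℕ.+ b ≡ N → (i ⊕ a) ⊕ b ≡ i
  ⊕-N i {a} {b} a+b≡N = ι-injective (begin
    ι ((i ⊕ a) ⊕ b)     ≈⟨ ι-⊕-⊕ i a b ⟩
    ι i + + (a ℕ.+ b)   ≡⟨ cong (λ n → ι i + + n) a+b≡N ⟩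
    ι i + + N           ≈⟨ +-congˡ (ι i) N≈0 ⟩
    ι i + + 0           ≡⟨ ℤP.+-identityʳ (ι i) ⟩
    ι i                 ∎)
    where open ≈-Reasoning

  ⊕1⊕M : ∀ i → (i ⊕ 1) ⊕ M ≡ i
  ⊕1⊕M i = ⊕-N i refl

  ⊕M⊕1 : ∀ i → (i ⊕ M) ⊕ 1 ≡ i
  ⊕M⊕1 i = ⊕-N i (ℕP.+-comm M 1)

  ⊕0 : ∀ i → i ⊕ 0 ≡ i
  ⊕0 i = ι-injective (≈-trans (ι-⊕ i 0) (≈-reflexive (ℤP.+-identityʳ (ι i))))

  ⊕-cancelˡ : ∀ i {a b} → a < N → b < N → i ⊕ a ≡ i ⊕ b → a ≡ b
  ⊕-cancelˡ i a< b< e = ≈⇒≡-ℕ a< b< (+-cancelˡ {ι i} (≈-trans (≈-sym (ι-⊕ i _)) (≈-trans (≈-reflexive (cong ι e)) (ι-⊕ i _))))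

  ⊕-suc : ∀ i k → (i ⊕ k) ⊕ 1 ≡ i ⊕ suc k
  ⊕-suc i k = ι-injective (begin
    ι ((i ⊕ k) ⊕ 1)     ≈⟨ ι-⊕-⊕ i k 1 ⟩
    ι i + + (k ℕ.+ 1)   ≡⟨ cong (λ n → ι i + + n) (ℕP.+-comm k 1) ⟩
    ι i + + suc k       ≈⟨ ι-⊕ i (suc k) ⟨
    ι (i ⊕ suc k)       ∎)
    where open ≈-Reasoning

  ⊕-reach : ∀ i j → i ⊕ (N ℕ.∸ toℕ i ℕ.+ toℕ j) ≡ j
  ⊕-reach i j = ι-injective (begin
    ι (i ⊕ (N ℕ.∸ t ℕ.+ toℕ j))   ≈⟨ ι-⊕ i _ ⟩
    ι i + + (N ℕ.∸ t ℕ.+ toℕ j)   ≡⟨ cong (_+ + (N ℕ.∸ t ℕ.+ toℕ j)) (ι-def i) ⟩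
    + t + + (N ℕ.∸ t ℕ.+ toℕ j)   ≡⟨ ℤP.pos-+ t _ ⟨
    + (t ℕ.+ (N ℕ.∸ t ℕ.+ toℕ j)) ≡⟨ cong +_ (ℕP.+-assoc t _ (toℕ j)) ⟨
    + (t ℕ.+ (N ℕ.∸ t) ℕ.+ toℕ j) ≡⟨ cong (λ n → + (n ℕ.+ toℕ j)) (ℕP.m+[n∸m]≡n (ℕP.<⇒≤ (FP.toℕ<n i))) ⟩
    + (N ℕ.+ toℕ j)               ≡⟨ ℤP.pos-+ N (toℕ j) ⟩
    + N + + toℕ j                 ≈⟨ +-congʳ (+ toℕ j) N≈0 ⟩
    + 0 + + toℕ j                 ≡⟨ ℤP.+-identityˡ _ ⟩
    + toℕ j                       ≡⟨ ι-def j ⟨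
    ι j                           ∎)
    where
      open ≈-Reasoning
      t : ℕ
      t = toℕ i

injective⇒surjective : ∀ {n} (f : Fin n → Fin n) → Injective _≡_ _≡_ f → ∀ a → ∃ λ i → f i ≡ a
injective⇒surjective {zero} f inj ()
injective⇒surjective {suc n} f inj a with FP.any? (λ i → f i F.≟ a)
... | yes hit = hit
... | no miss = ⊥-elim (ℕP.<-irrefl refl (FP.injective⇒≤ {f = g} g-injective))
  where
    a≢f : ∀ i → a ≢ f i
    a≢f i e = miss (i , sym e)
    g : Fin (suc n) → Fin n
    g i = F.punchOut (a≢f i)
    g-injective : Injective _≡_ _≡_ g
    g-injective e = inj (FP.punchOut-injective (a≢f _) (a≢f _) e)

module Polygon (M : ℕ) (M≥2 : 2 ≤ M) (P : Ordering (suc M)) where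
  open Congruence M public

  σ : Fin N → Fin N
  σ = proj₁ P

  σ-injective : Injective _≡_ _≡_ σ
  σ-injective = proj₂ P

  σ-surjective : ∀ a → ∃ λ i → σ i ≡ a
  σ-surjective = injective⇒surjective σ σ-injective

  Adjℤ : ℤ → ℤ → Set
  Adjℤ x y = Adj σ ⌊ x ⌋ ⌊ y ⌋

  Adjℤ-resp : ∀ {x y x' y'} → x ≈ x' → y ≈ y' → Adjℤ x y → Adjℤ x' y'
  Adjℤ-resp p q = subst₂ (Adj σ) (⌊⌋-cong p) (⌊⌋-cong q)

  Adjℤ-sym : ∀ {x y} → Adjℤ x y → Adjℤ y x
  Adjℤ-sym (i , inj₁ e) = i , inj₂ e
  Adjℤ-sym (i , inj₂ e) = i , inj₁ e

  Adj⇒Adjℤ : ∀ {a b} → Adj σ a b → Adjℤ (ι a) (ι b)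
  Adj⇒Adjℤ {a} {b} = subst₂ (Adj σ) (sym (⌊ι⌋ a)) (sym (⌊ι⌋ b))

  Adjℤ⇒Adj : ∀ {a b} → Adjℤ (ι a) (ι b) → Adj σ a b
  Adjℤ⇒Adj {a} {b} = subst₂ (Adj σ) (⌊ι⌋ a) (⌊ι⌋ b)

  Adj-next : ∀ i → Adj σ (σ i) (σ (i ⊕ 1))
  Adj-next i = i , inj₁ (refl , refl)

  Adj-prev : ∀ i → Adj σ (σ i) (σ (i ⊕ M))
  Adj-prev i = i ⊕ M , inj₂ (refl , cong σ (⊕M⊕1 i))

  Adj-neighbours : ∀ i b → Adj σ (σ i) b → b ≡ σ (i ⊕ 1) ⊎ b ≡ σ (i ⊕ M)
  Adj-neighbours i b (j , inj₁ (σj≡σi , σj⊕1≡b)) with σ-injective σj≡σi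
  ... | refl = inj₁ (sym σj⊕1≡b)
  Adj-neighbours i b (j , inj₂ (σj≡b , σj⊕1≡σi)) with σ-injective σj⊕1≡σi
  ... | refl = inj₂ (trans (sym σj≡b) (cong σ (sym (⊕1⊕M j))))

  private
    1<N : 1 < N
    1<N = s≤s (ℕP.<-≤-trans (s≤s z≤n) M≥2)

    0<M : 0 < M
    0<M = ℕP.<-≤-trans (s≤s z≤n) M≥2

  next≢prev : ∀ i → σ (i ⊕ 1) ≢ σ (i ⊕ M)
  next≢prev i e = ℕP.<-irrefl (⊕-cancelˡ i 1<N (ℕP.n<1+n M) (σ-injective e)) M≥2

  next≢self : ∀ i → σ (i ⊕ 1) ≢ σ i
  next≢self i e = ℕP.1+n≢0 (⊕-cancelˡ i 1<N (s≤s z≤n) (trans (σ-injective e) (sym (⊕0 i))))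

  prev≢self : ∀ i → σ (i ⊕ M) ≢ σ i
  prev≢self i e = ℕP.<-irrefl (sym (⊕-cancelˡ i (ℕP.n<1+n M) (s≤s z≤n) (trans (σ-injective e) (sym (⊕0 i))))) 0<M

  vertex : ∀ x → ∃ λ i → σ i ≡ ⌊ x ⌋
  vertex x = σ-surjective ⌊ x ⌋

  Adjℤ-irrefl : ∀ x → ¬ Adjℤ x x
  Adjℤ-irrefl x adj with i , σi≡x ← vertex x
      with Adj-neighbours i ⌊ x ⌋ (subst (λ v → Adj σ v ⌊ x ⌋) (sym σi≡x) adj)
  ... | inj₁ e = next≢self i (trans (sym e) (sym σi≡x))
  ... | inj₂ e = prev≢self i (trans (sym e) (sym σi≡x))

  Adjℤ-atMostTwo : ∀ {x y z w} → Adjℤ x y → Adjℤ x z → ¬ (y ≈ z) → Adjℤ x w → w ≈ y ⊎ w ≈ z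
  Adjℤ-atMostTwo {x} {y} {z} {w} x-y x-z y≉z x-w with i , σi≡x ← vertex x =
    decide (neighbour x-y) (neighbour x-z) (neighbour x-w)
    where
      Near : ℤ → Set
      Near v = ⌊ v ⌋ ≡ σ (i ⊕ 1) ⊎ ⌊ v ⌋ ≡ σ (i ⊕ M)
      neighbour : ∀ {v} → Adjℤ x v → Near v
      neighbour {v} adj = Adj-neighbours i ⌊ v ⌋ (subst (λ u → Adj σ u ⌊ v ⌋) (sym σi≡x) adj)
      y≢z : ⌊ y ⌋ ≢ ⌊ z ⌋
      y≢z e = y≉z (⌊⌋-injective e)
      decide : Near y → Near z → Near w → w ≈ y ⊎ w ≈ z
      decide (inj₁ a) (inj₁ b) _ = ⊥-elim (y≢z (trans a (sym b)))
      decide (inj₂ a) (inj₂ b) _ = ⊥-elim (y≢z (trans a (sym b)))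
      decide (inj₁ a) (inj₂ b) (inj₁ c) = inj₁ (⌊⌋-injective (trans c (sym a)))
      decide (inj₁ a) (inj₂ b) (inj₂ c) = inj₂ (⌊⌋-injective (trans c (sym b)))
      decide (inj₂ a) (inj₁ b) (inj₁ c) = inj₂ (⌊⌋-injective (trans c (sym b)))
      decide (inj₂ a) (inj₁ b) (inj₂ c) = inj₁ (⌊⌋-injective (trans c (sym a)))

  Adjℤ-twoNeighbours : ∀ x → Σ ℤ λ y → Σ ℤ λ z → Adjℤ x y × Adjℤ x z × ¬ (y ≈ z)
  Adjℤ-twoNeighbours x with i , σi≡x ← vertex x =
    ι (σ (i ⊕ 1)) , ι (σ (i ⊕ M)) , from (Adj-next i) , from (Adj-prev i) , λ e → next≢prev i (ι-injective e)
    where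
      from : ∀ {v} → Adj σ (σ i) v → Adjℤ x (ι v)
      from {v} = subst₂ (Adj σ) σi≡x (sym (⌊ι⌋ v))

  Adjℤ-connected : (Q : ℤ → Set) → (∀ {x y} → x ≈ y → Q x → Q y) → (∀ {x y} → Q x → Adjℤ x y → Q y) →
                   ∀ {x₀} → Q x₀ → ∀ a → Q (ι a)
  Adjℤ-connected Q resp step {x₀} Qx₀ a with i₀ , σi₀≡x₀ ← vertex x₀ | j , refl ← σ-surjective a =
    subst Qσ (⊕-reach i₀ j) (walk (N ℕ.∸ toℕ i₀ ℕ.+ toℕ j))
    where
      Qσ : Fin N → Set
      Qσ i = Q (ι (σ i))
      walk : ∀ k → Qσ (i₀ ⊕ k)
      walk zero = subst Qσ (sym (⊕0 i₀)) (resp (≈-trans (≈-sym (ι⌊⌋ x₀)) (≈-reflexive (cong ι (sym σi₀≡x₀)))) Qx₀)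
      walk (suc k) = subst Qσ (⊕-suc i₀ k) (step (walk k) (Adj⇒Adjℤ (Adj-next (i₀ ⊕ k))))

module Modulus (k : ℕ) where

  p : ℕ
  p = 3 ℕ.+ k

  -- N = suc M = 2p.
  M : ℕ
  M = ℕ.pred (2 ℕ.* p)

  open Congruence M

  N≡p*2 : + N ≡ + p * + 2
  N≡p*2 = trans (cong +_ (ℕP.*-comm 2 p)) (ℤP.pos-* p 2)

  N≡double-p : N ≡ double p
  N≡double-p = trans (cong (p ℕ.+_) (ℕP.+-identityʳ p)) (sym (double≡+ p))

  <p⇒suc-double<N : ∀ {m} → m < p → suc (double m) < N
  <p⇒suc-double<N {m} m<p = subst (suc (double m) <_) (sym N≡double-p) (suc-double-< m<p)

  double<N⇒<p : ∀ {m} → double m < N → m < p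
  double<N⇒<p {m} lt = double-<-cancel (subst (double m <_) N≡double-p lt)

  suc-double<N⇒<p : ∀ {m} → suc (double m) < N → m < p
  suc-double<N⇒<p {m} lt = double<N⇒<p (ℕP.<-trans (ℕP.n<1+n (double m)) lt)

  multiple-even : ∀ q → Even (q * + N)
  multiple-even q = subst Even (cong (q *_) (sym N≡p*2)) (*-even q (double-even (+ p)))

  Even-resp : ∀ {x y} → x ≈ y → Even x → Even y
  Even-resp {x} {y} (mk≈ q e) ex = subst Even (x-[x-y]≡y x y) (even-even ex (subst Even (sym e) (multiple-even q)))

  Odd-resp : ∀ {x y} → x ≈ y → Odd x → Odd y
  Odd-resp {x} {y} (mk≈ q e) ox = subst Odd (x-[x-y]≡y x y) (odd-even ox (subst Even (sym e) (multiple-even q)))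

  -- Every polygon with p axes turns out to be a zigzag: each even x is joined to x + b and
  -- to x + c, for two odd steps b and c.
  Step : ℤ → ℤ → ℤ → ℤ → Set
  Step b c x y = Even x × (y ≈ x + b ⊎ y ≈ x + c)

  Zigzag : ℤ → ℤ → ℤ → ℤ → Set
  Zigzag b c x y = Step b c x y ⊎ Step b c y x

  Step-resp : ∀ {b c x y x' y'} → x ≈ x' → y ≈ y' → Step b c x y → Step b c x' y'
  Step-resp {b} {c} {x} {y} {x'} {y'} x≈ y≈ (ex , s) = Even-resp x≈ ex , Sum.map move move s
    where
      move : ∀ {d} → y ≈ x + d → y' ≈ x' + d
      move {d} q = ≈-trans (≈-sym y≈) (≈-trans q (+-congʳ d x≈))

  Zigzag-resp : ∀ {b c x y x' y'} → x ≈ x' → y ≈ y' → Zigzag b c x y → Zigzag b c x' y'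
  Zigzag-resp x≈ y≈ = Sum.map (Step-resp x≈ y≈) (Step-resp y≈ x≈)

  Step-cong : ∀ {b c b' c' x y} → b ≈ b' → c ≈ c' → Step b c x y → Step b' c' x y
  Step-cong {x = x} b≈ c≈ (ex , s) = ex , Sum.map (λ q → ≈-trans q (+-congˡ x b≈)) (λ q → ≈-trans q (+-congˡ x c≈)) s

  Zigzag-cong : ∀ {b c b' c' x y} → b ≈ b' → c ≈ c' → Zigzag b c x y → Zigzag b' c' x y
  Zigzag-cong b≈ c≈ = Sum.map (Step-cong b≈ c≈) (Step-cong b≈ c≈)

  Zigzag-swap : ∀ {b c x y} → Zigzag b c x y → Zigzag c b x y
  Zigzag-swap = Sum.map (Prod.map₂ Sum.swap) (Prod.map₂ Sum.swap)

  Zigzag-sym : ∀ {b c x y} → Zigzag b c x y → Zigzag b c y x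
  Zigzag-sym = Sum.swap

  Zigzag-shift-even : ∀ {b c x y r} → Even r → Zigzag b c x y → Zigzag b c (x + r) (y + r)
  Zigzag-shift-even {b} {c} {r = r} er = Sum.map shift shift
    where
      shift : ∀ {x y} → Step b c x y → Step b c (x + r) (y + r)
      shift {x} {y} (ex , s) = even+even ex er , Sum.map move move s
        where
          move : ∀ {d} → y ≈ x + d → y + r ≈ (x + r) + d
          move {d} q = begin
            y + r        ≈⟨ +-congʳ r q ⟩
            x + d + r    ≡⟨ solve (x ∷ d ∷ r ∷ []) ⟩
            x + r + d    ∎
            where open ≈-Reasoning

  private
    odd-end : ∀ {x y d} → Even x → Odd d → y ≈ x + d → Odd y
    odd-end ex od q = Odd-resp (≈-sym q) (even+odd ex od)

  -- An odd shift exchanges the even and the odd ends of every edge.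
  Zigzag-shift-odd : ∀ {b c x y r} → Odd r → Odd b → Odd c → Zigzag b c x y → Zigzag (- b) (- c) (x + r) (y + r)
  Zigzag-shift-odd {b} {c} {r = r} or ob oc = Sum.swap ∘ Sum.map shift shift
    where
      flip : ∀ {x y d} → Even x → Odd d → y ≈ x + d → Even (y + r) × x + r ≈ (y + r) + - d
      flip {x} {y} {d} ex od q = odd+odd (odd-end ex od q) or , (begin
        x + r              ≡⟨ solve (x ∷ r ∷ d ∷ []) ⟩
        x + d + r + - d    ≈⟨ +-congʳ (- d) (+-congʳ r (≈-sym q)) ⟩
        y + r + - d        ∎)
        where open ≈-Reasoning
      shift : ∀ {x y} → Step b c x y → Step (- b) (- c) (y + r) (x + r)
      shift (ex , inj₁ q) = Prod.map₂ inj₁ (flip ex ob q)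
      shift (ex , inj₂ q) = Prod.map₂ inj₂ (flip ex oc q)

  Zigzag-reflect-odd : ∀ {b c x y s} → Odd s → Odd b → Odd c → Zigzag b c x y → Zigzag b c (s - x) (s - y)
  Zigzag-reflect-odd {b} {c} {s = s} os ob oc = Sum.swap ∘ Sum.map reflect′ reflect′
    where
      flip : ∀ {x y d} → Even x → Odd d → y ≈ x + d → Even (s - y) × s - x ≈ (s - y) + d
      flip {x} {y} {d} ex od q = odd-odd os (odd-end ex od q) , (begin
        s - x              ≡⟨ solve (s ∷ x ∷ d ∷ []) ⟩
        s - (x + d) + d    ≈⟨ +-congʳ d (sub-cong (≈-refl {s}) (≈-sym q)) ⟩
        s - y + d          ∎)
        where open ≈-Reasoning
      reflect′ : ∀ {x y} → Step b c x y → Step b c (s - y) (s - x)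
      reflect′ (ex , inj₁ q) = Prod.map₂ inj₁ (flip ex ob q)
      reflect′ (ex , inj₂ q) = Prod.map₂ inj₂ (flip ex oc q)

  Zigzag-reflect-even : ∀ {b c x y s} → Even s → Zigzag b c x y → Zigzag (- b) (- c) (s - x) (s - y)
  Zigzag-reflect-even {b} {c} {s = s} es = Sum.map reflect′ reflect′
    where
      reflect′ : ∀ {x y} → Step b c x y → Step (- b) (- c) (s - x) (s - y)
      reflect′ {x} {y} (ex , t) = even-even es ex , Sum.map move move t
        where
          move : ∀ {d} → y ≈ x + d → s - y ≈ (s - x) + - d
          move {d} q = begin
            s - y          ≈⟨ sub-cong (≈-refl {s}) q ⟩
            s - (x + d)    ≡⟨ solve (s ∷ x ∷ d ∷ []) ⟩
            s - x + - d    ∎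
            where open ≈-Reasoning

  Zigzag-0 : ∀ {b c} → Zigzag b c (+ 0) b
  Zigzag-0 {b} = inj₁ (double-even (+ 0) , inj₁ (≈-reflexive (sym (ℤP.+-identityˡ b))))

  Zigzag-from-0 : ∀ {b c z} → Odd z → Zigzag b c (+ 0) z → z ≈ b ⊎ z ≈ c
  Zigzag-from-0 {b} {c} oz (inj₁ (_ , s)) = Sum.map (λ q → ≈-trans q (≈-reflexive (ℤP.+-identityˡ b)))
                                                     (λ q → ≈-trans q (≈-reflexive (ℤP.+-identityˡ c))) s
  Zigzag-from-0 oz (inj₂ (ez , _)) = ⊥-elim (even⇒¬odd ez oz)

  -- b and c are recovered as the odd neighbours of 0.
  Zigzag-steps : ∀ {b c b' c'} → Odd b → Odd c → ¬ (b ≈ c) →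
                 (∀ {x y} → Zigzag b c x y → Zigzag b' c' x y) → (b ≈ b' × c ≈ c') ⊎ (b ≈ c' × c ≈ b')
  Zigzag-steps ob oc b≉c sub with Zigzag-from-0 ob (sub Zigzag-0) | Zigzag-from-0 oc (sub (Zigzag-swap Zigzag-0))
  ... | inj₁ b≈b' | inj₁ c≈b' = ⊥-elim (b≉c (≈-trans b≈b' (≈-sym c≈b')))
  ... | inj₁ b≈b' | inj₂ c≈c' = inj₁ (b≈b' , c≈c')
  ... | inj₂ b≈c' | inj₁ c≈b' = inj₂ (b≈c' , c≈b')
  ... | inj₂ b≈c' | inj₂ c≈c' = ⊥-elim (b≉c (≈-trans b≈c' (≈-sym c≈c')))

  double≈0⇒multiple : ∀ {b} → b + b ≈ + 0 → ∃ λ q → b ≡ q * + p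
  double≈0⇒multiple {b} (mk≈ q e) = q , ℤP.*-cancelʳ-≡ b (q * + p) (+ 2) (begin
    b * + 2            ≡⟨ solve (b ∷ []) ⟩
    b + b - + 0        ≡⟨ e ⟩
    q * + N            ≡⟨ cong (q *_) N≡p*2 ⟩
    q * (+ p * + 2)    ≡⟨ ℤP.*-assoc q (+ p) (+ 2) ⟨
    q * + p * + 2      ∎)
    where open ≡-Reasoning

  module _ (p-odd : Odd (+ p)) where

    even-double≈0 : ∀ {b} → Even b → b + b ≈ + 0 → b ≈ + 0
    even-double≈0 {b} eb bb≈0 with q , b≡qp ← double≈0⇒multiple bb≈0 with parity q
    ... | inj₂ oq = ⊥-elim (even⇒¬odd eb (subst Odd (sym b≡qp) (odd*odd oq p-odd)))
    ... | inj₁ (even s q≡2s) = mk≈ s (begin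
      b - + 0            ≡⟨ ℤP.+-identityʳ b ⟩
      b                  ≡⟨ b≡qp ⟩
      q * + p            ≡⟨ cong (_* + p) q≡2s ⟩
      s * + 2 * + p      ≡⟨ reorder s (+ p) ⟩
      s * (+ p * + 2)    ≡⟨ cong (s *_) N≡p*2 ⟨
      s * + N            ∎)
      where
        open ≡-Reasoning
        reorder : ∀ s P → s * + 2 * P ≡ s * (P * + 2)
        reorder = solve-∀

    odd-double≈0 : ∀ {t} → Odd t → t + t ≈ + 0 → t ≈ + p
    odd-double≈0 {t} ot tt≈0 with q , t≡qp ← double≈0⇒multiple tt≈0 with parity q
    ... | inj₁ eq = ⊥-elim (even⇒¬odd (subst Even (trans (ℤP.*-comm (+ p) q) (sym t≡qp)) (*-even (+ p) eq)) ot)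
    ... | inj₂ (odd (even s 1+q≡2s)) = mk≈ (s - + 1) (begin
      t - + p                        ≡⟨ cong (_- + p) t≡qp ⟩
      q * + p - + p                  ≡⟨ expand q (+ p) ⟩
      (+ 1 + q) * + p - + p * + 2    ≡⟨ cong (λ z → z * + p - + p * + 2) 1+q≡2s ⟩
      s * + 2 * + p - + p * + 2      ≡⟨ collect s (+ p) ⟩
      (s - + 1) * (+ p * + 2)        ≡⟨ cong ((s - + 1) *_) N≡p*2 ⟨
      (s - + 1) * + N                ∎)
      where
        open ≡-Reasoning
        expand : ∀ q P → q * P - P ≡ (+ 1 + q) * P - P * + 2
        expand = solve-∀
        collect : ∀ s P → s * + 2 * P - P * + 2 ≡ (s - + 1) * (P * + 2)
        collect = solve-∀

  IsZigzag : (Fin N → Fin N) → ℤ → ℤ → Set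
  IsZigzag σ b c = (∀ x y → Adj σ ⌊ x ⌋ ⌊ y ⌋ → Zigzag b c x y) × (∀ x y → Zigzag b c x y → Adj σ ⌊ x ⌋ ⌊ y ⌋)

  record ZigzagForm (σ : Fin N → Fin N) : Set where
    field
      b c : ℤ
      b-odd : Odd b
      c-odd : Odd c
      b≉c : ¬ (b ≈ c)
      b+c≉0 : ¬ (b + c ≈ + 0)
      isZigzag : IsZigzag σ b c

module Symmetries (k : ℕ) (P : Ordering (2 ℕ.* (3 ℕ.+ k))) where
  open Modulus k public
  open Polygon M (s≤s (s≤s z≤n)) P public

  Rotation : ℤ → Set
  Rotation r = (∀ x y → Adjℤ x y → Adjℤ (x + r) (y + r)) × (∀ x y → Adjℤ (x + r) (y + r) → Adjℤ x y)

  Axis : ℤ → Set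
  Axis c = ∀ x y → Adjℤ x y → Adjℤ (c - x) (c - y)

  Rotation-resp : ∀ {r r'} → r ≈ r' → Rotation r → Rotation r'
  Rotation-resp r≈ (fwd , bwd) =
    (λ x y a → Adjℤ-resp (+-congˡ x r≈) (+-congˡ y r≈) (fwd x y a)) ,
    (λ x y a → bwd x y (Adjℤ-resp (+-congˡ x (≈-sym r≈)) (+-congˡ y (≈-sym r≈)) a))

  Rotation-0 : Rotation (+ 0)
  Rotation-0 = (λ x y → Adjℤ-resp (≈-reflexive (sym (ℤP.+-identityʳ x))) (≈-reflexive (sym (ℤP.+-identityʳ y)))) ,
               (λ x y → Adjℤ-resp (≈-reflexive (ℤP.+-identityʳ x)) (≈-reflexive (ℤP.+-identityʳ y)))

  Rotation-+ : ∀ {r s} → Rotation r → Rotation s → Rotation (r + s)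
  Rotation-+ {r} {s} (fwd , bwd) (fwd' , bwd') =
    (λ x y a → Adjℤ-resp (assoc x) (assoc y) (fwd' _ _ (fwd x y a))) ,
    (λ x y a → bwd x y (bwd' _ _ (Adjℤ-resp (≈-sym (assoc x)) (≈-sym (assoc y)) a)))
    where
      assoc : ∀ x → x + r + s ≈ x + (r + s)
      assoc x = ≈-reflexive (ℤP.+-assoc x r s)

  Rotation-neg : ∀ {r} → Rotation r → Rotation (- r)
  Rotation-neg {r} (fwd , bwd) =
    (λ x y a → bwd _ _ (Adjℤ-resp (cancel x) (cancel y) a)) ,
    (λ x y a → Adjℤ-resp (≈-sym (cancel x)) (≈-sym (cancel y)) (fwd _ _ a))
    where
      cancel : ∀ x → x ≈ x + - r + r
      cancel x = ≈-reflexive (solve (x ∷ r ∷ []))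

  Rotation-*ℕ : ∀ {r} → Rotation r → ∀ m → Rotation (+ m * r)
  Rotation-*ℕ {r} R zero = Rotation-resp (≈-reflexive (sym (ℤP.*-zeroˡ r))) Rotation-0
  Rotation-*ℕ {r} R (suc m) = Rotation-resp (≈-reflexive (step (+ m) r)) (Rotation-+ R (Rotation-*ℕ R m))
    where
      step : ∀ m r → r + m * r ≡ (+ 1 + m) * r
      step = solve-∀

  Rotation-* : ∀ {r} → Rotation r → ∀ m → Rotation (m * r)
  Rotation-* R (+ m) = Rotation-*ℕ R m
  Rotation-* {r} R -[1+ m ] = Rotation-resp (≈-reflexive (ℤP.neg-distribˡ-* (+ suc m) r)) (Rotation-neg (Rotation-*ℕ R (suc m)))

  Axis-resp : ∀ {c c'} → c ≈ c' → Axis c → Axis c'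
  Axis-resp c≈ X x y a = Adjℤ-resp (sub-cong c≈ (≈-refl {x})) (sub-cong c≈ (≈-refl {y})) (X x y a)

  Axis-involutive : ∀ {c} → Axis c → ∀ x y → Adjℤ (c - x) (c - y) → Adjℤ x y
  Axis-involutive {c} X x y a = Adjℤ-resp (≈-reflexive (x-[x-y]≡y c x)) (≈-reflexive (x-[x-y]≡y c y)) (X _ _ a)

  Axis-Axis⇒Rotation : ∀ {c d} → Axis c → Axis d → Rotation (c - d)
  Axis-Axis⇒Rotation {c} {d} X Y =
    (λ x y a → Adjℤ-resp (compose x) (compose y) (X _ _ (Y x y a))) ,
    (λ x y a → Axis-involutive {d} Y x y (Axis-involutive {c} X _ _ (Adjℤ-resp (≈-sym (compose x)) (≈-sym (compose y)) a)))
    where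
      compose : ∀ x → c - (d - x) ≈ x + (c - d)
      compose x = ≈-reflexive (solve (c ∷ d ∷ x ∷ []))

  Axis-+ : ∀ {c r} → Axis c → Rotation r → Axis (c + r)
  Axis-+ {c} {r} X (fwd , _) x y a = Adjℤ-resp (move x) (move y) (fwd _ _ (X _ _ a))
    where
      move : ∀ x → c - x + r ≈ c + r - x
      move x = ≈-reflexive (solve (c ∷ x ∷ r ∷ []))

  IsAxis⇒Axis : ∀ c → IsAxis P c → Axis (ι c)
  IsAxis⇒Axis c ax x y a = Adjℤ-resp (reflect≈ x) (reflect≈ y) (Adj⇒Adjℤ (Equivalence.to (ax ⌊ x ⌋ ⌊ y ⌋) a))
    where
      reflect≈ : ∀ x → ι (reflect c ⌊ x ⌋) ≈ ι c - x
      reflect≈ x = ≈-trans (ι-reflect c ⌊ x ⌋) (sub-cong (≈-refl {ι c}) (ι⌊⌋ x))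

  Axis⇒IsAxis : ∀ c → Axis (ι c) → IsAxis P c
  Axis⇒IsAxis c X a b = mk⇔
    (λ adj → Adjℤ⇒Adj (Adjℤ-resp (≈-sym (ι-reflect c a)) (≈-sym (ι-reflect c b)) (X _ _ (Adj⇒Adjℤ adj))))
    (λ adj → Adjℤ⇒Adj (Axis-involutive {ι c} X _ _ (Adjℤ-resp (ι-reflect c a) (ι-reflect c b) (Adj⇒Adjℤ adj))))

inverse-mod-prime : ∀ {p e} → Prime p → 0 < e → e < p → ∃ λ x → ∃ λ y → x * + e ≡ + 1 + y * + p
inverse-mod-prime {p} {e} pr 0<e e<p with coprime-Bézout (Coprime.sym (prime⇒coprime pr {{ℕ.>-nonZero 0<e}} e<p))
... | Bézout.+- x y eq = + x , + y , (begin
  + x * + e            ≡⟨ ℤP.pos-* x e ⟨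
  + (x ℕ.* e)          ≡⟨ cong +_ eq ⟨
  + (1 ℕ.+ y ℕ.* p)    ≡⟨ cong (λ z → + 1 + z) (ℤP.pos-* y p) ⟩
  + 1 + + y * + p      ∎)
  where open ≡-Reasoning
... | Bézout.-+ x y eq = - + x , - + y , (begin
  - + x * + e                ≡⟨ negate (+ x) (+ e) ⟩
  + 1 + - (+ 1 + + x * + e)  ≡⟨ cong (λ z → + 1 + - (+ 1 + z)) (ℤP.pos-* x e) ⟨
  + 1 + - + (1 ℕ.+ x ℕ.* e)  ≡⟨ cong (λ z → + 1 + - + z) eq ⟩
  + 1 + - + (y ℕ.* p)        ≡⟨ cong (λ z → + 1 + - z) (ℤP.pos-* y p) ⟩
  + 1 + - (+ y * + p)        ≡⟨ cong (λ z → + 1 + z) (ℤP.neg-distribˡ-* (+ y) (+ p)) ⟩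
  + 1 + - + y * + p          ∎)
  where
    open ≡-Reasoning
    negate : ∀ a b → - a * b ≡ + 1 + - (+ 1 + a * b)
    negate = solve-∀

module _ {q e : ℕ} (pr : Prime (suc q)) (0<e : 0 < e) (e<p : e < suc q) where
  open Congruence q

  *-cancelʳ-mod-prime : ∀ {m m'} → m < N → m' < N → + m * + e ≈ + m' * + e → m ≡ m'
  *-cancelʳ-mod-prime {m} {m'} m< m'< me≈m'e with x , y , xe≡1+yp ← inverse-mod-prime pr 0<e e<p =
    ≈⇒≡-ℕ m< m'< (begin
      + m                  ≈⟨ unscale m ⟨
      x * (+ m * + e)      ≈⟨ *-congˡ x me≈m'e ⟩
      x * (+ m' * + e)     ≈⟨ unscale m' ⟩
      + m'                 ∎)
    where
      open ≈-Reasoning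
      swap : ∀ x n e → x * (n * e) ≡ n * (x * e)
      swap = solve-∀
      expand : ∀ n y P → n * (+ 1 + y * P) ≡ n + n * y * P
      expand = solve-∀
      unscale : ∀ n → x * (+ n * + e) ≈ + n
      unscale n = begin
        x * (+ n * + e)           ≡⟨ swap x (+ n) (+ e) ⟩
        + n * (x * + e)           ≡⟨ cong (+ n *_) xe≡1+yp ⟩
        + n * (+ 1 + y * + N)     ≡⟨ expand (+ n) y (+ N) ⟩
        + n + + n * y * + N       ≈⟨ +-multiple (+ n) (+ n * y) ⟩
        + n                       ∎

parity-pigeonhole : ∀ x y z → Even (x - y) ⊎ Even (x - z) ⊎ Even (y - z)
parity-pigeonhole x y z with parity x | parity y | parity z
... | inj₁ ex | inj₁ ey | _       = inj₁ (even-even ex ey)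
... | inj₂ ox | inj₂ oy | _       = inj₁ (odd-odd ox oy)
... | inj₁ ex | inj₂ _  | inj₁ ez = inj₂ (inj₁ (even-even ex ez))
... | inj₂ ox | inj₁ _  | inj₂ oz = inj₂ (inj₁ (odd-odd ox oz))
... | inj₁ _  | inj₂ oy | inj₂ oz = inj₂ (inj₂ (odd-odd oy oz))
... | inj₂ _  | inj₁ ey | inj₁ ez = inj₂ (inj₂ (even-even ey ez))

all∈⇒≤length : ∀ {n} {xs : List (Fin n)} → (∀ a → a ∈ xs) → n ≤ length xs
all∈⇒≤length {n} all∈ = FP.injective⇒≤ {f = λ a → Any.index (all∈ a)}
  (λ {a} {b} → SetoidMembership.index-injective (setoid (Fin n)) (all∈ a) (all∈ b))

even-ℕ : ∀ {t} → Even (+ t) → ∃ λ e → t ≡ e ℕ.* 2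
even-ℕ {t} (even (+ e) eq) = e , ℤP.+-injective (trans eq (sym (ℤP.pos-* e 2)))

module PrimeSymmetries (k : ℕ) (pr : Prime (3 ℕ.+ k)) (P : Ordering (2 ℕ.* (3 ℕ.+ k))) where
  open Symmetries k P public

  -- e is invertible modulo p, so a multiple of 2e is 2 modulo 2p.
  Rotation-2e⇒Rotation-2 : ∀ {e} → 0 < e → e < p → Rotation (+ (e ℕ.* 2)) → Rotation (+ 2)
  Rotation-2e⇒Rotation-2 {e} 0<e e<p R with x , y , xe≡1+yp ← inverse-mod-prime pr 0<e e<p =
    Rotation-resp x*2e≈2 (Rotation-* R x)
    where
      x*2e≈2 : x * + (e ℕ.* 2) ≈ + 2
      x*2e≈2 = begin
        x * + (e ℕ.* 2)           ≡⟨ cong (x *_) (ℤP.pos-* e 2) ⟩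
        x * (+ e * + 2)           ≡⟨ ℤP.*-assoc x (+ e) (+ 2) ⟨
        x * + e * + 2             ≡⟨ cong (_* + 2) xe≡1+yp ⟩
        (+ 1 + y * + p) * + 2     ≡⟨ rearrange y (+ p) ⟩
        + 2 + y * (+ p * + 2)     ≡⟨ cong (λ z → + 2 + y * z) N≡p*2 ⟨
        + 2 + y * + N             ≈⟨ +-multiple (+ 2) y ⟩
        + 2                       ∎
        where
          open ≈-Reasoning
          rearrange : ∀ y P → (+ 1 + y * P) * + 2 ≡ + 2 + y * (P * + 2)
          rearrange = solve-∀

  Rotation-even⇒Rotation-2 : ∀ {r} → Rotation r → Even r → ¬ (r ≈ + 0) → Rotation (+ 2)
  Rotation-even⇒Rotation-2 {r} R er r≉0 = halve (even-ℕ (Even-resp (≈-sym t≈r) er))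
    where
      t : ℕ
      t = toℕ ⌊ r ⌋
      t≈r : + t ≈ r
      t≈r = ≈-trans (≈-reflexive (sym (ι-def ⌊ r ⌋))) (ι⌊⌋ r)
      halve : ∃ (λ e → t ≡ e ℕ.* 2) → Rotation (+ 2)
      halve (e , t≡e*2) = Rotation-2e⇒Rotation-2 0<e e<p (Rotation-resp (≈-trans (≈-sym t≈r) t≈2e) R)
        where
          t≈2e : + t ≈ + (e ℕ.* 2)
          t≈2e = ≈-reflexive (cong +_ t≡e*2)
          0<e : 0 < e
          0<e = ℕP.n≢0⇒n>0 λ e≡0 → r≉0 (≈-trans (≈-sym t≈r) (≈-trans t≈2e (≈-reflexive (cong (λ n → + (n ℕ.* 2)) e≡0))))
          e<p : e < p
          e<p = ℕP.*-cancelʳ-< 2 e p (subst₂ _<_ t≡e*2 (ℕP.*-comm 2 p) (FP.toℕ<n ⌊ r ⌋))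

  Axis-pair⇒Rotation-2 : ∀ {c d} → c ≢ d → Axis (ι c) → Axis (ι d) → Even (ι c - ι d) → Rotation (+ 2)
  Axis-pair⇒Rotation-2 {c} {d} c≢d X Y ev =
    Rotation-even⇒Rotation-2 (Axis-Axis⇒Rotation {ι c} {ι d} X Y) ev (λ c-d≈0 → c≢d (ι-injective (difference≈0⇒≈ c-d≈0)))

  module _ (H : HasAxes p P) where

    private
      axes : List (Fin N)
      axes = proj₁ H

      member⇔IsAxis : ∀ c → c ∈ axes ⇔ IsAxis P c
      member⇔IsAxis = proj₂ (proj₂ (proj₂ H))

    member⇒Axis : ∀ {c} → c ∈ axes → Axis (ι c)
    member⇒Axis {c} c∈ = IsAxis⇒Axis c (Equivalence.to (member⇔IsAxis c) c∈)

    Axis⇒member : ∀ c → Axis (ι c) → c ∈ axes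
    Axis⇒member c X = Equivalence.from (member⇔IsAxis c) (Axis⇒IsAxis c X)

    Rotation-2 : Rotation (+ 2)
    Rotation-2 = three-axes axes member⇒Axis (proj₁ (proj₂ H)) (proj₁ (proj₂ (proj₂ H)))
      where
        open All using (_∷_)
        open AllPairs using (_∷_)
        three-axes : ∀ cs → (∀ {c} → c ∈ cs → Axis (ι c)) → Unique cs → length cs ≡ p → Rotation (+ 2)
        three-axes (c₁ ∷ c₂ ∷ c₃ ∷ _) X ((c₁≢c₂ ∷ c₁≢c₃ ∷ _) ∷ (c₂≢c₃ ∷ _) ∷ _) _
          with parity-pigeonhole (ι c₁) (ι c₂) (ι c₃)
        ... | inj₁ e        = Axis-pair⇒Rotation-2 c₁≢c₂ (X (here refl)) (X (there (here refl))) e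
        ... | inj₂ (inj₁ e) = Axis-pair⇒Rotation-2 c₁≢c₃ (X (here refl)) (X (there (there (here refl)))) e
        ... | inj₂ (inj₂ e) = Axis-pair⇒Rotation-2 c₂≢c₃ (X (there (here refl))) (X (there (there (here refl)))) e

    -- Rotation by 1 would make all 2p reflections axes.
    ¬Rotation-1 : ¬ Rotation (+ 1)
    ¬Rotation-1 R1 = ℕP.<-irrefl refl (ℕP.<-≤-trans p<N (ℕP.≤-trans (all∈⇒≤length all-axes) (ℕP.≤-reflexive (proj₁ (proj₂ (proj₂ H))))))
      where
        p<N : p < N
        p<N = ℕP.m<m+n p {p ℕ.+ 0} (s≤s z≤n)
        c₀∈ : Σ (Fin N) (_∈ axes)
        c₀∈ = first axes (proj₁ (proj₂ (proj₂ H)))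
          where
            first : ∀ cs → length cs ≡ p → Σ (Fin N) (_∈ cs)
            first (c ∷ _) _ = c , here refl
        all-axes : ∀ c → c ∈ axes
        all-axes c = Axis⇒member c (Axis-resp (≈-reflexive (a+[b-a]≡b (ι c₀) (ι c)))
                       (Axis-+ {ι c₀} {ι c - ι c₀} (member⇒Axis (proj₂ c₀∈)) (Rotation-resp (≈-reflexive (ℤP.*-identityʳ (ι c - ι c₀))) (Rotation-* R1 (ι c - ι c₀)))))
          where
            c₀ : Fin N
            c₀ = proj₁ c₀∈
            a+[b-a]≡b : ∀ a b → a + (b - a) ≡ b
            a+[b-a]≡b = solve-∀

module Structure (k : ℕ) (p-odd : Odd (+ (3 ℕ.+ k))) (P : Ordering (2 ℕ.* (3 ℕ.+ k))) where
  open Symmetries k P public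

  module _ (R2 : Rotation (+ 2)) (¬R1 : ¬ Rotation (+ 1)) where

    Rotation-even : ∀ {r} → Even r → Rotation r
    Rotation-even (even q r≡q*2) = Rotation-resp (≈-reflexive (sym r≡q*2)) (Rotation-* R2 q)

    Adjℤ-from-even : ∀ {x z} → Adjℤ (+ 0) z → Even x → Adjℤ x (x + z)
    Adjℤ-from-even {x} {z} 0-z ex =
      Adjℤ-resp (≈-reflexive (ℤP.+-identityˡ x)) (≈-reflexive (ℤP.+-comm z x)) (proj₁ (Rotation-even ex) _ _ 0-z)

    Adjℤ-to-even : ∀ {y z} → Adjℤ (+ 0) z → Even (y - z) → Adjℤ y (y - z)
    Adjℤ-to-even {y} {z} 0-z e = Adjℤ-sym (Adjℤ-resp (≈-refl {y - z}) (≈-reflexive (x-y+y≡x y z)) (Adjℤ-from-even 0-z e))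
      where
        x-y+y≡x : ∀ x y → x - y + y ≡ x
        x-y+y≡x = solve-∀

    -- If 0 had an even neighbour z, the neighbours x ± z of every even x would be even,
    -- and the polygon would never reach an odd vertex.
    neighbour-of-0-odd : ∀ {z} → Adjℤ (+ 0) z → Odd z
    neighbour-of-0-odd {z} 0-z with parity z
    ... | inj₂ oz = oz
    ... | inj₁ ez = ⊥-elim (even⇒¬odd (Adjℤ-connected Even Even-resp step (double-even (+ 0)) ⌊ + 1 ⌋) ι⌊1⌋-odd)
      where
        ι⌊1⌋-odd : Odd (ι ⌊ + 1 ⌋)
        ι⌊1⌋-odd = Odd-resp (≈-sym (ι⌊⌋ (+ 1))) 1-odd
        z≉-z : ∀ x → ¬ (x + z ≈ x - z)
        z≉-z x x+z≈x-z = Adjℤ-irrefl (+ 0) (Adjℤ-resp (≈-refl {+ 0}) (even-double≈0 p-odd ez z+z≈0) 0-z)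
          where
            z+z≈0 : z + z ≈ + 0
            z+z≈0 = begin
              z + z                ≡⟨ solve (x ∷ z ∷ []) ⟩
              x + z + (z - x)      ≈⟨ +-congʳ (z - x) x+z≈x-z ⟩
              x - z + (z - x)      ≡⟨ solve (x ∷ z ∷ []) ⟩
              + 0                  ∎
              where open ≈-Reasoning
        step : ∀ {x y} → Even x → Adjℤ x y → Even y
        step {x} {y} ex x-y = Sum.[ (λ y≈x+z → Even-resp (≈-sym y≈x+z) (even+even ex ez))
                                 , (λ y≈x-z → Even-resp (≈-sym y≈x-z) (even-even ex ez)) ]′
          (Adjℤ-atMostTwo (Adjℤ-from-even 0-z ex) (Adjℤ-to-even 0-z (even-even ex ez)) (z≉-z x) x-y)

    Adjℤ-from-odd : ∀ {y z} → Adjℤ (+ 0) z → Odd z → Odd y → Adjℤ y (y - z)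
    Adjℤ-from-odd 0-z oz oy = Adjℤ-to-even 0-z (odd-odd oy oz)

    module FromNeighbours {b c} (0-b : Adjℤ (+ 0) b) (0-c : Adjℤ (+ 0) c) (b≉c : ¬ (b ≈ c)) where

      b-odd : Odd b
      b-odd = neighbour-of-0-odd 0-b

      c-odd : Odd c
      c-odd = neighbour-of-0-odd 0-c

      private
        x+b≉x+c : ∀ x → ¬ (x + b ≈ x + c)
        x+b≉x+c x q = b≉c (+-cancelˡ {x} q)

        x-b≉x-c : ∀ x → ¬ (x - b ≈ x - c)
        x-b≉x-c x q = b≉c (≈-trans (≈-reflexive (sym (x-[x-y]≡y x b)))
                                    (≈-trans (sub-cong (≈-refl {x}) q) (≈-reflexive (x-[x-y]≡y x c))))

      Adjℤ⇒Zigzag : ∀ x y → Adjℤ x y → Zigzag b c x y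
      Adjℤ⇒Zigzag x y x-y = Sum.[ from-even , from-odd′ ]′ (parity x)
        where
          from-even : Even x → Zigzag b c x y
          from-even ex = inj₁ (ex , Adjℤ-atMostTwo (Adjℤ-from-even 0-b ex) (Adjℤ-from-even 0-c ex) (x+b≉x+c x) x-y)
          flip : ∀ {d} → Odd x → Odd d → y ≈ x - d → Even y × x ≈ y + d
          flip {d} ox od y≈x-d = Even-resp (≈-sym y≈x-d) (odd-odd ox od) , (begin
            x            ≡⟨ solve (x ∷ d ∷ []) ⟩
            x - d + d    ≈⟨ +-congʳ d (≈-sym y≈x-d) ⟩
            y + d        ∎)
            where open ≈-Reasoning
          from-odd′ : Odd x → Zigzag b c x y
          from-odd′ ox = inj₂ (Sum.[ (λ q → Prod.map₂ inj₁ (flip ox b-odd q)) , (λ q → Prod.map₂ inj₂ (flip ox c-odd q)) ]′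
            (Adjℤ-atMostTwo (Adjℤ-from-odd 0-b b-odd ox) (Adjℤ-from-odd 0-c c-odd ox) (x-b≉x-c x) x-y))

      Zigzag⇒Adjℤ : ∀ x y → Zigzag b c x y → Adjℤ x y
      Zigzag⇒Adjℤ x y (inj₁ (ex , inj₁ q)) = Adjℤ-resp ≈-refl (≈-sym q) (Adjℤ-from-even 0-b ex)
      Zigzag⇒Adjℤ x y (inj₁ (ex , inj₂ q)) = Adjℤ-resp ≈-refl (≈-sym q) (Adjℤ-from-even 0-c ex)
      Zigzag⇒Adjℤ x y (inj₂ (ey , inj₁ q)) = Adjℤ-sym (Adjℤ-resp ≈-refl (≈-sym q) (Adjℤ-from-even 0-b ey))
      Zigzag⇒Adjℤ x y (inj₂ (ey , inj₂ q)) = Adjℤ-sym (Adjℤ-resp ≈-refl (≈-sym q) (Adjℤ-from-even 0-c ey))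

      -- If b + c ≈ 0, the shift by 1 maps Zigzag b c to Zigzag (- b) (- c) = Zigzag c b.
      b+c≉0 : ¬ (b + c ≈ + 0)
      b+c≉0 b+c≈0 = ¬R1 (fwd , bwd)
        where
          -b≈c : - b ≈ c
          -b≈c = +≈0⇒neg≈ b+c≈0
          -c≈b : - c ≈ b
          -c≈b = +≈0⇒neg≈ (≈-trans (≈-reflexive (ℤP.+-comm c b)) b+c≈0)
          unflip : ∀ {x y} → Zigzag (- b) (- c) x y → Zigzag b c x y
          unflip z = Zigzag-swap (Zigzag-cong -b≈c -c≈b z)
          fwd : ∀ x y → Adjℤ x y → Adjℤ (x + + 1) (y + + 1)
          fwd x y a = Zigzag⇒Adjℤ _ _ (unflip (Zigzag-shift-odd 1-odd b-odd c-odd (Adjℤ⇒Zigzag x y a)))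
          bwd : ∀ x y → Adjℤ (x + + 1) (y + + 1) → Adjℤ x y
          bwd x y a = Zigzag⇒Adjℤ x y (unflip (Zigzag-resp (undo x) (undo y) (Zigzag-shift-odd (neg-odd 1-odd) b-odd c-odd (Adjℤ⇒Zigzag _ _ a))))
            where
              x+1-1≡x : ∀ x → x + + 1 + - + 1 ≡ x
              x+1-1≡x = solve-∀
              undo : ∀ x → x + + 1 + - + 1 ≈ x
              undo x = ≈-reflexive (x+1-1≡x x)

    zigzagForm : ZigzagForm σ
    zigzagForm = fromNeighbours (Adjℤ-twoNeighbours (+ 0))
      where
        fromNeighbours : (Σ ℤ λ b → Σ ℤ λ c → Adjℤ (+ 0) b × Adjℤ (+ 0) c × ¬ (b ≈ c)) → ZigzagForm σ
        fromNeighbours (b , c , 0-b , 0-c , b≉c) = record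
          { b = b ; c = c ; b-odd = b-odd ; c-odd = c-odd ; b≉c = b≉c ; b+c≉0 = b+c≉0
          ; isZigzag = Adjℤ⇒Zigzag , Zigzag⇒Adjℤ }
          where open FromNeighbours 0-b 0-c b≉c

-- The zigzag with steps U = T + D and T, where T = 2i + 1 and D = 2e, traversed in the order
-- 0, U, D, D + U, 2D, 2D + U, …
module Construction (k : ℕ) (pr : Prime (3 ℕ.+ k)) (i e : ℕ) (0<e : 0 < e) (cond : i ℕ.* 2 ℕ.+ e ℕ.+ 2 ≤ 3 ℕ.+ k) where
  open Modulus k
  open Congruence M

  T D U : ℤ
  T = + suc (i ℕ.* 2)
  D = + (e ℕ.* 2)
  U = T + D

  corner : ℕ → ℤ
  corner zero = + 0
  corner (suc zero) = U
  corner (suc (suc n)) = corner n + D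

  corner-shift : ∀ r n → corner (double r ℕ.+ n) ≡ + r * D + corner n
  corner-shift zero n = sym (ℤP.+-identityˡ (corner n))
  corner-shift (suc r) n = trans (cong (_+ D) (corner-shift r n)) (step (+ r) D (corner n))
    where
      step : ∀ r d x → r * d + x + d ≡ (+ 1 + r) * d + x
      step = solve-∀

  corner-double : ∀ m → corner (double m) ≡ + m * D
  corner-double m = trans (cong corner (sym (ℕP.+-identityʳ (double m)))) (trans (corner-shift m 0) (ℤP.+-identityʳ (+ m * D)))

  corner-suc-double : ∀ m → corner (suc (double m)) ≡ + m * D + U
  corner-suc-double m = trans (cong corner (sym (ℕP.+-comm (double m) 1))) (corner-shift m 1)

  p*D≡e*N : + p * D ≡ + e * + N
  p*D≡e*N = trans (cong (+ p *_) (ℤP.pos-* e 2)) (trans (swap (+ p) (+ e)) (cong (+ e *_) (sym N≡p*2)))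
    where
      swap : ∀ P E → P * (E * + 2) ≡ E * (P * + 2)
      swap = solve-∀

  +-p*D : ∀ x → x + + p * D ≈ x
  +-p*D x = ≈-trans (≈-reflexive (cong (λ z → x + z) p*D≡e*N)) (+-multiple x (+ e))

  corner-+N : ∀ n → corner (N ℕ.+ n) ≈ corner n
  corner-+N n = begin
    corner (N ℕ.+ n)               ≡⟨ cong (λ m → corner (m ℕ.+ n)) N≡double-p ⟩
    corner (double p ℕ.+ n)        ≡⟨ corner-shift p n ⟩
    + p * D + corner n             ≡⟨ ℤP.+-comm (+ p * D) (corner n) ⟩
    corner n + + p * D             ≈⟨ +-p*D (corner n) ⟩
    corner n                       ∎
    where open ≈-Reasoning

  corner-mod : ∀ n → corner (n ℕ.% N) ≈ corner n
  corner-mod n = ≈-sym (≈-trans (≈-reflexive (cong corner (trans (ℕD.m≡m%n+[m/n]*n n N) (ℕP.+-comm (n ℕ.% N) _))))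
                                 (periodic (n ℕ./ N) (n ℕ.% N)))
    where
      periodic : ∀ b r → corner (b ℕ.* N ℕ.+ r) ≈ corner r
      periodic zero r = ≈-refl
      periodic (suc b) r = ≈-trans (≈-reflexive (cong corner (ℕP.+-assoc N (b ℕ.* N) r))) (≈-trans (corner-+N _) (periodic b r))

  D-even : Even D
  D-even = subst Even (sym (ℤP.pos-* e 2)) (double-even (+ e))

  T-odd : Odd T
  T-odd = subst (λ n → Odd (+ suc n)) (double≡*2 i) (suc-double-odd i)

  U-odd : Odd U
  U-odd = odd+even T-odd D-even

  corner-double-even : ∀ m → Even (corner (double m))
  corner-double-even m = subst Even (sym (corner-double m)) (*-even (+ m) D-even)

  corner-suc-double-odd : ∀ m → Odd (corner (suc (double m)))
  corner-suc-double-odd m = subst Odd (trans (ℤP.+-comm U (+ m * D)) (sym (corner-suc-double m))) (odd+even U-odd (*-even (+ m) D-even))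

  e<p : e < p
  e<p = ℕP.<-≤-trans (ℕP.m<m+n e (s≤s z≤n)) (ℕP.≤-trans (ℕP.m≤n+m (e ℕ.+ 2) (i ℕ.* 2))
          (ℕP.≤-trans (ℕP.≤-reflexive (sym (ℕP.+-assoc (i ℕ.* 2) e 2))) cond))

  private
    module ModP = Congruence (2 ℕ.+ k)

    halve : ∀ {m m'} → + m * D ≈ + m' * D → + m * + e ModP.≈ + m' * + e
    halve {m} {m'} (mk≈ q eq) = ModP.mk≈ q (ℤP.*-cancelʳ-≡ _ _ (+ 2) (begin
      (+ m * + e - + m' * + e) * + 2        ≡⟨ distrib (+ m) (+ m') (+ e) ⟩
      + m * (+ e * + 2) - + m' * (+ e * + 2) ≡⟨ cong (λ d → + m * d - + m' * d) (ℤP.pos-* e 2) ⟨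
      + m * D - + m' * D                    ≡⟨ eq ⟩
      q * + N                               ≡⟨ cong (q *_) N≡p*2 ⟩
      q * (+ p * + 2)                       ≡⟨ ℤP.*-assoc q (+ p) (+ 2) ⟨
      q * + p * + 2                         ∎))
      where
        open ≡-Reasoning
        distrib : ∀ m m' e → (m * e - m' * e) * + 2 ≡ m * (e * + 2) - m' * (e * + 2)
        distrib = solve-∀

  *D-injective : ∀ {m m'} → m < p → m' < p → + m * D ≈ + m' * D → m ≡ m'
  *D-injective {m} {m'} m< m'< q = *-cancelʳ-mod-prime pr 0<e e<p m< m'< (halve {m} {m'} q)

  corner-injective : ∀ {n n'} → n < N → n' < N → corner n ≈ corner n' → n ≡ n'
  corner-injective {n} {n'} n< n'< q with double-or-suc-double n | double-or-suc-double n'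
  ... | m , inj₁ refl | m' , inj₁ refl = cong double (*D-injective (double<N⇒<p n<) (double<N⇒<p n'<)
          (≈-trans (≈-reflexive (sym (corner-double m))) (≈-trans q (≈-reflexive (corner-double m')))))
  ... | m , inj₂ refl | m' , inj₂ refl = cong (suc ∘ double) (*D-injective (suc-double<N⇒<p n<) (suc-double<N⇒<p n'<)
          (+-cancelʳ (≈-trans (≈-reflexive (sym (corner-suc-double m))) (≈-trans q (≈-reflexive (corner-suc-double m'))))))
  ... | m , inj₁ refl | m' , inj₂ refl = ⊥-elim (even⇒¬odd (Even-resp q (corner-double-even m)) (corner-suc-double-odd m'))
  ... | m , inj₂ refl | m' , inj₁ refl = ⊥-elim (even⇒¬odd (Even-resp (≈-sym q) (corner-double-even m')) (corner-suc-double-odd m))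

  σ₀ : Fin N → Fin N
  σ₀ a = ⌊ corner (toℕ a) ⌋

  ι-σ₀ : ∀ a → ι (σ₀ a) ≈ corner (toℕ a)
  ι-σ₀ a = ι⌊⌋ (corner (toℕ a))

  σ₀-injective : Injective _≡_ _≡_ σ₀
  σ₀-injective {a} {b} eq = FP.toℕ-injective (corner-injective (FP.toℕ<n a) (FP.toℕ<n b)
    (≈-trans (≈-sym (ι-σ₀ a)) (≈-trans (≈-reflexive (cong ι eq)) (ι-σ₀ b))))

  polygon : Ordering N
  polygon = σ₀ , σ₀-injective

module OddResidues (k : ℕ) where
  open Modulus k
  open Congruence M

  oddResidue : ℕ → ℤ
  oddResidue m = + suc (double m)

  oddResidue-odd : ∀ m → Odd (oddResidue m)
  oddResidue-odd = suc-double-odd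

  oddResidue-injective : ∀ {m n} → m < p → n < p → oddResidue m ≈ oddResidue n → m ≡ n
  oddResidue-injective m< n< q = double-injective (ℕP.suc-injective (≈⇒≡-ℕ (<p⇒suc-double<N m<) (<p⇒suc-double<N n<) q))

  odd⇒oddResidue : ∀ {x} → Odd x → ∃ λ m → m < p × x ≈ oddResidue m
  odd⇒oddResidue {x} ox with double-or-suc-double (toℕ ⌊ x ⌋)
  ... | m , inj₁ r≡2m = ⊥-elim (even⇒¬odd (subst Even (sym (trans (cong +_ r≡2m) (+double≡*2 m))) (double-even (+ m)))
                                          (Odd-resp (≈-trans (≈-sym (ι⌊⌋ x)) (≈-reflexive (ι-def ⌊ x ⌋))) ox))
  ... | m , inj₂ r≡2m+1 = m , suc-double<N⇒<p (subst (_< N) r≡2m+1 (FP.toℕ<n ⌊ x ⌋)) ,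
                          ≈-trans (≈-sym (ι⌊⌋ x)) (≈-reflexive (trans (ι-def ⌊ x ⌋) (cong +_ r≡2m+1)))

  oddResidue-+ : ∀ m n → oddResidue m + oddResidue n ≡ + double (suc (m ℕ.+ n))
  oddResidue-+ m n = begin
    oddResidue m + oddResidue n             ≡⟨ cong₂ _+_ (unfold m) (unfold n) ⟩
    + 1 + + m * + 2 + (+ 1 + + n * + 2)     ≡⟨ collect (+ m) (+ n) ⟩
    (+ 1 + (+ m + + n)) * + 2               ≡⟨ cong (λ z → (+ 1 + z) * + 2) (ℤP.pos-+ m n) ⟨
    (+ 1 + + (m ℕ.+ n)) * + 2               ≡⟨ +double≡*2 (suc (m ℕ.+ n)) ⟨
    + double (suc (m ℕ.+ n))                ∎
    where
      open ≡-Reasoning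
      unfold : ∀ m → oddResidue m ≡ + 1 + + m * + 2
      unfold m = trans (ℤP.pos-+ 1 (double m)) (cong (λ z → + 1 + z) (+double≡*2 m))
      collect : ∀ m n → + 1 + m * + 2 + (+ 1 + n * + 2) ≡ (+ 1 + (m + n)) * + 2
      collect = solve-∀

  private
    double<N : ∀ {s} → s < p → double s < N
    double<N {s} s<p = ℕP.<-trans (ℕP.n<1+n (double s)) (<p⇒suc-double<N s<p)

  double≈0 : ∀ {s} → s < double p → + double s ≈ + 0 → s ≡ 0 ⊎ s ≡ p
  double≈0 {s} s<2p q with ℕP.<-cmp s p
  ... | tri< s<p _ _ = inj₁ (double-injective {s} {0} (≈⇒≡-ℕ (double<N s<p) (s≤s z≤n) q))
  ... | tri≈ _ s≡p _ = inj₂ s≡p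
  ... | tri> _ _ s>p = ⊥-elim (ℕP.<-irrefl (sym s≡p) s>p)
    where
      s' : ℕ
      s' = s ℕ.∸ p
      s≡s'+p : s ≡ s' ℕ.+ p
      s≡s'+p = sym (ℕP.m∸n+n≡m (ℕP.<⇒≤ s>p))
      s'<p : s' < p
      s'<p = ℕP.+-cancelʳ-< p s' p (subst (_< p ℕ.+ p) s≡s'+p (subst (s <_) (double≡+ p) s<2p))
      double-s : double s' ℕ.+ N ≡ double s
      double-s = begin
        double s' ℕ.+ N             ≡⟨ cong₂ ℕ._+_ (double≡+ s') (trans N≡double-p (double≡+ p)) ⟩
        s' ℕ.+ s' ℕ.+ (p ℕ.+ p)     ≡⟨ interchange s' p ⟩
        s' ℕ.+ p ℕ.+ (s' ℕ.+ p)     ≡⟨ cong (λ n → n ℕ.+ n) s≡s'+p ⟨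
        s ℕ.+ s                     ≡⟨ double≡+ s ⟨
        double s                    ∎
        where
          open ≡-Reasoning
          interchange : ∀ a b → a ℕ.+ a ℕ.+ (b ℕ.+ b) ≡ a ℕ.+ b ℕ.+ (a ℕ.+ b)
          interchange = ℕSolver.solve-∀
      double-s'≈0 : + double s' ≈ + 0
      double-s'≈0 = begin
        + double s'                     ≈⟨ +-multiple (+ double s') (+ 1) ⟨
        + double s' + + 1 * + N         ≡⟨ cong (λ z → + double s' + z) (ℤP.*-identityˡ (+ N)) ⟩
        + double s' + + N               ≡⟨ trans (sym (ℤP.pos-+ (double s') N)) (cong +_ double-s) ⟩
        + double s                      ≈⟨ q ⟩
        + 0                             ∎
        where open ≈-Reasoning
      s≡p : s ≡ p
      s≡p = trans s≡s'+p (cong (ℕ._+ p) (double-injective {s'} {0} (≈⇒≡-ℕ (double<N s'<p) (s≤s z≤n) double-s'≈0)))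

  oddResidue-sum≈0 : ∀ {m n} → m < p → n < p → oddResidue m + oddResidue n ≈ + 0 → suc (m ℕ.+ n) ≡ p
  oddResidue-sum≈0 {m} {n} m< n< q =
    Sum.[ (λ ()) , id ]′ (double≈0 s<2p (≈-trans (≈-reflexive (sym (oddResidue-+ m n))) q))
    where
      s<2p : suc (m ℕ.+ n) < double p
      s<2p = subst (suc (m ℕ.+ n) <_) (sym (double≡+ p)) (ℕP.+-mono-≤-< m< n<)

  oddResidue-sum-p : ∀ {m n} → suc (m ℕ.+ n) ≡ p → oddResidue m + oddResidue n ≈ + 0
  oddResidue-sum-p {m} {n} s≡p = begin
    oddResidue m + oddResidue n     ≡⟨ oddResidue-+ m n ⟩
    + double (suc (m ℕ.+ n))        ≡⟨ cong (+_ ∘ double) s≡p ⟩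
    + double p                      ≡⟨ cong +_ N≡double-p ⟨
    + N                             ≈⟨ N≈0 ⟩
    + 0                             ∎
    where open ≈-Reasoning

  neg-oddResidue : ∀ {m} → m < p → - oddResidue m ≈ oddResidue ((2 ℕ.+ k) ℕ.∸ m)
  neg-oddResidue m<p = +≈0⇒neg≈ (oddResidue-sum-p (cong suc (ℕP.m+[n∸m]≡n (ℕP.≤-pred m<p))))

  oddVertex : ℕ → Fin N
  oddVertex = ⌊_⌋ ∘ oddResidue

  oddVertices : List (Fin N)
  oddVertices = applyUpTo oddVertex p

  oddVertices-unique : Unique oddVertices
  oddVertices-unique = AllPairsP.applyUpTo⁺₁ oddVertex p
    (λ a<b b<p eq → ℕP.<-irrefl (oddResidue-injective (ℕP.<-trans a<b b<p) b<p (⌊⌋-injective eq)) a<b)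

  oddVertices-length : length oddVertices ≡ p
  oddVertices-length = ListP.length-applyUpTo oddVertex p

  ∈oddVertices⇔odd : ∀ c → c ∈ oddVertices ⇔ Odd (ι c)
  ∈oddVertices⇔odd c = mk⇔ to from
    where
      to : c ∈ oddVertices → Odd (ι c)
      to c∈ with m , _ , c≡ ← MembershipP.∈-applyUpTo⁻ oddVertex c∈ =
        Odd-resp (≈-trans (≈-sym (ι⌊⌋ (oddResidue m))) (≈-reflexive (cong ι (sym c≡)))) (oddResidue-odd m)
      from : Odd (ι c) → c ∈ oddVertices
      from oc with m , m<p , c≈ ← odd⇒oddResidue oc =
        subst (_∈ oddVertices) (trans (sym (⌊⌋-cong c≈)) (⌊ι⌋ c)) (MembershipP.∈-applyUpTo⁺ oddVertex m<p)

module Representative (k : ℕ) (pr : Prime (3 ℕ.+ k)) (i e : ℕ) (0<e : 0 < e) (cond : i ℕ.* 2 ℕ.+ e ℕ.+ 2 ≤ 3 ℕ.+ k) where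
  open Construction k pr i e 0<e cond public
  open Symmetries k polygon public
  open OddResidues k using (oddVertices; oddVertices-unique; oddVertices-length; ∈oddVertices⇔odd; double≈0)

  ι-σ-⊕ : ∀ a n → ι (σ (a ⊕ n)) ≈ corner (toℕ a ℕ.+ n)
  ι-σ-⊕ a n = ≈-trans (ι-σ₀ (a ⊕ n)) (≈-trans (≈-reflexive (cong corner (FP.toℕ-fromℕ< (ℕD.m%n<n (toℕ a ℕ.+ n) N))))
                                               (corner-mod (toℕ a ℕ.+ n)))

  private
    edge-even : ∀ m → Zigzag U T (corner (double m)) (corner (suc (double m)))
    edge-even m = inj₁ (corner-double-even m , inj₁ (≈-reflexive (trans (corner-suc-double m) (cong (_+ U) (sym (corner-double m))))))

    edge-odd : ∀ m → Zigzag U T (corner (suc (double m))) (corner (double (suc m)))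
    edge-odd m = inj₂ (corner-double-even (suc m) , inj₂ (≈-reflexive (begin
      corner (suc (double m))     ≡⟨ corner-suc-double m ⟩
      + m * D + (T + D)           ≡⟨ rearrange (+ m) T D ⟩
      (+ 1 + + m) * D + T         ≡⟨ cong (_+ T) (corner-double (suc m)) ⟨
      corner (double (suc m)) + T ∎)))
      where
        open ≡-Reasoning
        rearrange : ∀ m t d → m * d + (t + d) ≡ (+ 1 + m) * d + t
        rearrange = solve-∀

  edge : ∀ n → Zigzag U T (corner n) (corner (suc n))
  edge n = Sum.[ (λ n≡2m → subst Edge (sym n≡2m) (edge-even m)) , (λ n≡2m+1 → subst Edge (sym n≡2m+1) (edge-odd m)) ]′ n≡
    where
      Edge : ℕ → Set
      Edge n = Zigzag U T (corner n) (corner (suc n))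
      m : ℕ
      m = proj₁ (double-or-suc-double n)
      n≡ : n ≡ double m ⊎ n ≡ suc (double m)
      n≡ = proj₂ (double-or-suc-double n)

  Adjℤ⇒Zigzag : ∀ x y → Adjℤ x y → Zigzag U T x y
  Adjℤ⇒Zigzag x y (a , inj₁ (σa≡x , σa⊕1≡y)) = Zigzag-resp (at σa≡x) (next σa⊕1≡y) (edge (toℕ a))
    where
      at : ∀ {z} → σ a ≡ ⌊ z ⌋ → corner (toℕ a) ≈ z
      at {z} e = ≈-trans (≈-sym (ι-σ₀ a)) (≈-trans (≈-reflexive (cong ι e)) (ι⌊⌋ z))
      next : ∀ {z} → σ (a ⊕ 1) ≡ ⌊ z ⌋ → corner (suc (toℕ a)) ≈ z
      next {z} e = ≈-trans (≈-reflexive (cong corner (ℕP.+-comm 1 (toℕ a)))) (≈-trans (≈-sym (ι-σ-⊕ a 1)) (≈-trans (≈-reflexive (cong ι e)) (ι⌊⌋ z)))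
  Adjℤ⇒Zigzag x y (a , inj₂ (σa≡y , σa⊕1≡x)) = Zigzag-sym (Adjℤ⇒Zigzag y x (a , inj₁ (σa≡y , σa⊕1≡x)))

  private
    EvenPosition : ℤ → Set
    EvenPosition x = Σ (Fin N) λ a → Σ ℕ λ m → σ a ≡ ⌊ x ⌋ × toℕ a ≡ double m × + m * D ≈ x

    evenPosition : ∀ {x} → Even x → EvenPosition x
    evenPosition {x} ex = at (vertex x)
      where
        at : (Σ (Fin N) λ a → σ a ≡ ⌊ x ⌋) → EvenPosition x
        at (a , σa≡x) = Sum.[ even-index , odd-index ]′ (proj₂ (double-or-suc-double (toℕ a)))
          where
            m : ℕ
            m = proj₁ (double-or-suc-double (toℕ a))
            corner≈x : corner (toℕ a) ≈ x
            corner≈x = ≈-trans (≈-sym (ι-σ₀ a)) (≈-trans (≈-reflexive (cong ι σa≡x)) (ι⌊⌋ x))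
            even-index : toℕ a ≡ double m → EvenPosition x
            even-index a≡2m = a , m , σa≡x , a≡2m , ≈-trans (≈-reflexive (trans (sym (corner-double m)) (cong corner (sym a≡2m)))) corner≈x
            odd-index : toℕ a ≡ suc (double m) → EvenPosition x
            odd-index a≡2m+1 = ⊥-elim (even⇒¬odd ex (Odd-resp corner≈x (subst (Odd ∘ corner) (sym a≡2m+1) (corner-suc-double-odd m))))

    M≡2[p-1]+1 : M ≡ suc (double (2 ℕ.+ k))
    M≡2[p-1]+1 = trans (shape k) (cong suc (sym (double≡+ (2 ℕ.+ k))))
      where
        shape : ∀ k → suc (suc (k ℕ.+ (3 ℕ.+ k ℕ.+ 0))) ≡ suc ((2 ℕ.+ k) ℕ.+ (2 ℕ.+ k))
        shape = ℕSolver.solve-∀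

    σ-⊕≡ : ∀ a n {z} → corner (toℕ a ℕ.+ n) ≈ z → σ (a ⊕ n) ≡ ⌊ z ⌋
    σ-⊕≡ a n {z} q = ι-injective (≈-trans (ι-σ-⊕ a n) (≈-trans q (≈-sym (ι⌊⌋ z))))

    Adjℤ-+U : ∀ {x y} → Even x → y ≈ x + U → Adjℤ x y
    Adjℤ-+U {x} {y} ex y≈x+U = from (evenPosition ex)
      where
        from : EvenPosition x → Adjℤ x y
        from (a , m , σa≡x , a≡2m , mD≈x) = a , inj₁ (σa≡x , σ-⊕≡ a 1 (begin
          corner (toℕ a ℕ.+ 1)       ≡⟨ cong (λ n → corner (n ℕ.+ 1)) a≡2m ⟩
          corner (double m ℕ.+ 1)    ≡⟨ cong corner (ℕP.+-comm (double m) 1) ⟩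
          corner (suc (double m))    ≡⟨ corner-suc-double m ⟩
          + m * D + U                ≈⟨ +-congʳ U mD≈x ⟩
          x + U                      ≈⟨ y≈x+U ⟨
          y                          ∎))
          where open ≈-Reasoning

    -- The predecessor of position 2m is position 2m + M = 2m + 2(p - 1) + 1.
    Adjℤ-+T : ∀ {x y} → Even x → y ≈ x + T → Adjℤ x y
    Adjℤ-+T {x} {y} ex y≈x+T = from (evenPosition ex)
      where
        from : EvenPosition x → Adjℤ x y
        from (a , m , σa≡x , a≡2m , mD≈x) = a ⊕ M , inj₂ (σ-⊕≡ a M (begin
          corner (toℕ a ℕ.+ M)                             ≡⟨ cong₂ (λ n n' → corner (n ℕ.+ n')) a≡2m M≡2[p-1]+1 ⟩
          corner (double m ℕ.+ suc (double (2 ℕ.+ k)))     ≡⟨ corner-shift m _ ⟩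
          + m * D + corner (suc (double (2 ℕ.+ k)))        ≡⟨ cong (λ z → + m * D + z) (corner-suc-double (2 ℕ.+ k)) ⟩
          + m * D + (+ (2 ℕ.+ k) * D + (T + D))            ≡⟨ rearrange (+ m) (+ (2 ℕ.+ k)) D T ⟩
          + m * D + T + (+ 1 + + (2 ℕ.+ k)) * D            ≈⟨ +-p*D (+ m * D + T) ⟩
          + m * D + T                                      ≈⟨ +-congʳ T mD≈x ⟩
          x + T                                            ≈⟨ y≈x+T ⟨
          y                                                ∎) , trans (cong σ (⊕M⊕1 a)) σa≡x)
          where
            open ≈-Reasoning
            rearrange : ∀ m r d t → m * d + (r * d + (t + d)) ≡ m * d + t + (+ 1 + r) * d
            rearrange = solve-∀

  Zigzag⇒Adjℤ : ∀ x y → Zigzag U T x y → Adjℤ x y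
  Zigzag⇒Adjℤ x y (inj₁ (ex , s)) = Sum.[ Adjℤ-+U ex , Adjℤ-+T ex ]′ s
  Zigzag⇒Adjℤ x y (inj₂ (ey , s)) = Adjℤ-sym (Zigzag⇒Adjℤ y x (inj₁ (ey , s)))

  isZigzag : IsZigzag σ U T
  isZigzag = Adjℤ⇒Zigzag , Zigzag⇒Adjℤ

  U≉T : ¬ (U ≈ T)
  U≉T U≈T = ℕP.<-irrefl (sym e≡0) 0<e
    where
      D≈0 : D ≈ + 0
      D≈0 = +-cancelˡ {T} (≈-trans U≈T (≈-reflexive (sym (ℤP.+-identityʳ T))))
      2e<N : e ℕ.* 2 < N
      2e<N = subst (e ℕ.* 2 <_) (ℕP.*-comm p 2) (ℕP.*-monoˡ-< 2 e<p)
      e≡0 : e ≡ 0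
      e≡0 = ℕP.m*n≡0⇒m≡0 e 2 (≈⇒≡-ℕ 2e<N (s≤s z≤n) D≈0)

  U+T≉0 : ¬ (U + T ≈ + 0)
  U+T≉0 U+T≈0 = Sum.[ (λ ()) , (λ s≡p → ℕP.<-irrefl s≡p s<p) ]′ (double≈0 (subst (s <_) N≡double-p (ℕP.<-trans s<p (ℕP.m<m+n p {p ℕ.+ 0} (s≤s z≤n)))) double-s≈0)
    where
      s : ℕ
      s = suc (i ℕ.* 2 ℕ.+ e)
      s<p : s < p
      s<p = subst (_≤ p) (ℕP.+-comm (i ℕ.* 2 ℕ.+ e) 2) cond
      double-s≈0 : + double s ≈ + 0
      double-s≈0 = ≈-trans (≈-reflexive (begin
        + double s                                       ≡⟨ +double≡*2 s ⟩
        + s * + 2                                        ≡⟨ cong (_* + 2) (ℤP.pos-+ 1 (i ℕ.* 2 ℕ.+ e)) ⟩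
        (+ 1 + + (i ℕ.* 2 ℕ.+ e)) * + 2                  ≡⟨ cong (λ z → (+ 1 + z) * + 2) (trans (ℤP.pos-+ (i ℕ.* 2) e) (cong (_+ + e) (ℤP.pos-* i 2))) ⟩
        (+ 1 + (+ i * + 2 + + e)) * + 2                  ≡⟨ rearrange (+ i) (+ e) ⟩
        (+ 1 + + i * + 2) + + e * + 2 + (+ 1 + + i * + 2) ≡⟨ cong₂ (λ t d → t + d + t) T≡ (ℤP.pos-* e 2) ⟨
        U + T                                            ∎)) U+T≈0
        where
          open ≡-Reasoning
          rearrange : ∀ i e → (+ 1 + (i * + 2 + e)) * + 2 ≡ (+ 1 + i * + 2) + e * + 2 + (+ 1 + i * + 2)
          rearrange = solve-∀
          T≡ : T ≡ + 1 + + i * + 2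
          T≡ = trans (ℤP.pos-+ 1 (i ℕ.* 2)) (cong (λ z → + 1 + z) (ℤP.pos-* i 2))

  odd-Axis : ∀ {s} → Odd s → Axis s
  odd-Axis os x y a = Zigzag⇒Adjℤ _ _ (Zigzag-reflect-odd os U-odd T-odd (Adjℤ⇒Zigzag x y a))

  even-¬Axis : ∀ {s} → Even s → ¬ Axis s
  even-¬Axis {s} es X = Sum.[ same-steps , swapped-steps ]′ (Zigzag-steps U-odd T-odd U≉T reflected)
    where
      p-odd : Odd (+ p)
      p-odd = prime-odd pr (λ ())
      reflected : ∀ {x y} → Zigzag U T x y → Zigzag (- U) (- T) x y
      reflected {x} {y} z = Zigzag-resp (≈-reflexive (x-[x-y]≡y s x)) (≈-reflexive (x-[x-y]≡y s y))
                              (Zigzag-reflect-even es (Adjℤ⇒Zigzag _ _ (X x y (Zigzag⇒Adjℤ x y z))))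
      same-steps : U ≈ - U × T ≈ - T → ⊥
      same-steps (U≈-U , T≈-T) = U≉T (≈-trans (odd-double≈0 p-odd U-odd (≈neg⇒+≈0 U≈-U)) (≈-sym (odd-double≈0 p-odd T-odd (≈neg⇒+≈0 T≈-T))))
      swapped-steps : U ≈ - T × T ≈ - U → ⊥
      swapped-steps (U≈-T , _) = U+T≉0 (≈neg⇒+≈0 U≈-T)

  hasAxes : HasAxes p polygon
  hasAxes = oddVertices , oddVertices-unique , oddVertices-length , λ c → mk⇔
    (λ c∈ → Axis⇒IsAxis c (odd-Axis (Equivalence.to (∈oddVertices⇔odd c) c∈)))
    (λ ax → Equivalence.from (∈oddVertices⇔odd c) (Sum.[ (λ ec → ⊥-elim (even-¬Axis ec (IsAxis⇒Axis c ax))) , id ]′ (parity (ι c))))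

module Classes (k : ℕ) where
  open Modulus k public
  open Congruence M public
  open OddResidues k public

  private
    Adj⌊ι⌋ : ∀ {σ a b} → Adj σ a b → Adj σ ⌊ ι a ⌋ ⌊ ι b ⌋
    Adj⌊ι⌋ {σ} {a} {b} = subst₂ (Adj σ) (sym (⌊ι⌋ a)) (sym (⌊ι⌋ b))

    Adj⌊ι⌋⁻ : ∀ {σ a b} → Adj σ ⌊ ι a ⌋ ⌊ ι b ⌋ → Adj σ a b
    Adj⌊ι⌋⁻ {σ} {a} {b} = subst₂ (Adj σ) (⌊ι⌋ a) (⌊ι⌋ b)

  Zigzag-shift⇒Equiv : ∀ {P Q : Ordering N} {b c b' c'} r → IsZigzag (proj₁ P) b c → IsZigzag (proj₁ Q) b' c' →
                       (∀ x y → Zigzag b c x y → Zigzag b' c' (x + + r) (y + + r)) →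
                       (∀ x y → Zigzag b' c' (x + + r) (y + + r) → Zigzag b c x y) → Equiv P Q
  Zigzag-shift⇒Equiv r (toP , fromP) (toQ , fromQ) shift unshift = r , λ a a' → mk⇔
    (λ adj → Adj⌊ι⌋⁻ (fromQ _ _ (Zigzag-resp (≈-sym (ι-⊕ a r)) (≈-sym (ι-⊕ a' r)) (shift _ _ (toP _ _ (Adj⌊ι⌋ adj))))))
    (λ adj → Adj⌊ι⌋⁻ (fromP _ _ (unshift _ _ (Zigzag-resp (ι-⊕ a r) (ι-⊕ a' r) (toQ _ _ (Adj⌊ι⌋ adj))))))

  Equiv⇒Zigzag-shift : ∀ {P Q : Ordering N} {b c b' c'} → IsZigzag (proj₁ P) b c → IsZigzag (proj₁ Q) b' c' → Equiv P Q →
                       ∃ λ r → ∀ x y → Zigzag b c x y → Zigzag b' c' (x + + r) (y + + r)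
  Equiv⇒Zigzag-shift (_ , fromP) (toQ , _) (r , rotate) = r , λ x y z →
    Zigzag-resp (shifted x) (shifted y) (toQ _ _ (Adj⌊ι⌋ (Equivalence.to (rotate ⌊ x ⌋ ⌊ y ⌋) (fromP x y z))))
    where
      shifted : ∀ x → ι (⌊ x ⌋ ⊕ r) ≈ x + + r
      shifted x = ≈-trans (ι-⊕ ⌊ x ⌋ r) (+-congʳ (+ r) (ι⌊⌋ x))

  IsZigzag-cong : ∀ {σ b c b' c'} → b ≈ b' → c ≈ c' → IsZigzag σ b c → IsZigzag σ b' c'
  IsZigzag-cong b≈ c≈ (to , from) = (λ x y → Zigzag-cong b≈ c≈ ∘ to x y) , (λ x y → from x y ∘ Zigzag-cong (≈-sym b≈) (≈-sym c≈))

  SameSteps : ℤ → ℤ → ℤ → ℤ → Set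
  SameSteps b c b' c' = (b ≈ b' × c ≈ c') ⊎ (b ≈ c' × c ≈ b')

  -- An even shift keeps the parity of every vertex, an odd one exchanges the parities.
  Zigzag-shift⇒steps : ∀ {b c b' c' r} → Odd b → Odd c → Odd b' → Odd c' → ¬ (b ≈ c) →
                       (∀ x y → Zigzag b c x y → Zigzag b' c' (x + + r) (y + + r)) →
                       SameSteps b c b' c' ⊎ SameSteps b c (- b') (- c')
  Zigzag-shift⇒steps {b} {c} {b'} {c'} {r} ob oc ob' oc' b≉c shift = Sum.map even-shift odd-shift (parity (+ r))
    where
      unshift : ∀ x → x + + r + - + r ≈ x
      unshift x = ≈-reflexive (x+r-r≡x x (+ r))
        where
          x+r-r≡x : ∀ x r → x + r + - r ≡ x
          x+r-r≡x = solve-∀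
      even-shift : Even (+ r) → SameSteps b c b' c'
      even-shift er = Zigzag-steps ob oc b≉c λ {x} {y} z →
        Zigzag-resp (unshift x) (unshift y) (Zigzag-shift-even (neg-even er) (shift x y z))
      odd-shift : Odd (+ r) → SameSteps b c (- b') (- c')
      odd-shift or = Zigzag-steps ob oc b≉c λ {x} {y} z →
        Zigzag-resp (unshift x) (unshift y) (Zigzag-shift-odd (neg-odd or) ob' oc' (shift x y z))

  private
    SameSteps-sym : ∀ {b c b' c'} → SameSteps b c b' c' → SameSteps b' c' b c
    SameSteps-sym = Sum.map (Prod.map ≈-sym ≈-sym) (Prod.swap ∘ Prod.map ≈-sym ≈-sym)

    Zigzag-SameSteps : ∀ {b c b' c' x y} → SameSteps b c b' c' → Zigzag b c x y → Zigzag b' c' x y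
    Zigzag-SameSteps (inj₁ (b≈b' , c≈c')) = Zigzag-cong b≈b' c≈c'
    Zigzag-SameSteps (inj₂ (b≈c' , c≈b')) = Zigzag-swap ∘ Zigzag-cong b≈c' c≈b'

    +0≈ : ∀ x → x + + 0 ≈ x
    +0≈ x = ≈-reflexive (ℤP.+-identityʳ x)

  SameSteps⇒Equiv : ∀ {P Q : Ordering N} {b c b' c'} → IsZigzag (proj₁ P) b c → IsZigzag (proj₁ Q) b' c' →
                    SameSteps b c b' c' → Equiv P Q
  SameSteps⇒Equiv {P} {Q} zP zQ s = Zigzag-shift⇒Equiv {P} {Q} 0 zP zQ
    (λ x y → Zigzag-resp (≈-sym (+0≈ x)) (≈-sym (+0≈ y)) ∘ Zigzag-SameSteps s)
    (λ x y → Zigzag-SameSteps (SameSteps-sym s) ∘ Zigzag-resp (+0≈ x) (+0≈ y))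

  OppositeSteps⇒Equiv : ∀ {P Q : Ordering N} {b c b' c'} → Odd b → Odd c → IsZigzag (proj₁ P) b c → IsZigzag (proj₁ Q) b' c' →
                        SameSteps (- b) (- c) b' c' → Equiv P Q
  OppositeSteps⇒Equiv {P} {Q} {b} {c} ob oc zP zQ s = Zigzag-shift⇒Equiv {P} {Q} 1 zP zQ
    (λ x y → Zigzag-SameSteps s ∘ Zigzag-shift-odd 1-odd ob oc)
    (λ x y → Zigzag-cong (neg-involutive b) (neg-involutive c) ∘ Zigzag-resp (unshift x) (unshift y)
             ∘ Zigzag-shift-odd (neg-odd 1-odd) (neg-odd ob) (neg-odd oc) ∘ Zigzag-SameSteps (SameSteps-sym s))
    where
      neg-involutive : ∀ z → - - z ≈ z
      neg-involutive z = ≈-reflexive (ℤP.neg-involutive z)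
      unshift : ∀ x → x + + 1 + - + 1 ≈ x
      unshift x = ≈-reflexive (x+1-1≡x x)
        where
          x+1-1≡x : ∀ x → x + + 1 + - + 1 ≡ x
          x+1-1≡x = solve-∀

module Family (k : ℕ) (pr : Prime (3 ℕ.+ k)) where
  open Classes k

  Admissible : ℕ × ℕ → Set
  Admissible (i , j) = i < j × suc (suc (i ℕ.+ j)) ≤ p

  private
    construction-bound : ∀ {i j} → i < j → suc (suc (i ℕ.+ j)) ≤ p → i ℕ.* 2 ℕ.+ (j ℕ.∸ i) ℕ.+ 2 ≤ p
    construction-bound {i} {j} i<j bound = subst (_≤ p) (sym (trans (shape i (j ℕ.∸ i)) (cong (λ n → suc (suc (i ℕ.+ n))) (ℕP.m+[n∸m]≡n (ℕP.<⇒≤ i<j))))) bound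
      where
        shape : ∀ i d → i ℕ.* 2 ℕ.+ d ℕ.+ 2 ≡ suc (suc (i ℕ.+ (i ℕ.+ d)))
        shape = ℕSolver.solve-∀

    module Rep {i j} ((i<j , bound) : Admissible (i , j)) =
      Representative k pr i (j ℕ.∸ i) (ℕP.m<n⇒0<n∸m i<j) (construction-bound i<j bound)

  representative : ∀ x → Admissible x → Ordering N
  representative (i , j) adm = Rep.polygon adm

  representative-hasAxes : ∀ x adm → HasAxes p (representative x adm)
  representative-hasAxes (i , j) adm = Rep.hasAxes adm

  representative-isZigzag : ∀ x adm → IsZigzag (proj₁ (representative x adm)) (oddResidue (proj₂ x)) (oddResidue (proj₁ x))
  representative-isZigzag (i , j) adm@(i<j , _) = IsZigzag-cong (≈-reflexive U≡) (≈-reflexive T≡) (Rep.isZigzag adm)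
    where
      T≡ : Rep.T adm ≡ oddResidue i
      T≡ = cong (+_ ∘ suc) (sym (double≡*2 i))
      U≡ : Rep.U adm ≡ oddResidue j
      U≡ = begin
        + suc (i ℕ.* 2) + + ((j ℕ.∸ i) ℕ.* 2)   ≡⟨ ℤP.pos-+ (suc (i ℕ.* 2)) _ ⟨
        + suc (i ℕ.* 2 ℕ.+ (j ℕ.∸ i) ℕ.* 2)     ≡⟨ cong (+_ ∘ suc) (ℕP.*-distribʳ-+ 2 i (j ℕ.∸ i)) ⟨
        + suc ((i ℕ.+ (j ℕ.∸ i)) ℕ.* 2)         ≡⟨ cong (λ n → + suc (n ℕ.* 2)) (ℕP.m+[n∸m]≡n (ℕP.<⇒≤ i<j)) ⟩
        + suc (j ℕ.* 2)                         ≡⟨ cong (+_ ∘ suc) (double≡*2 j) ⟨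
        oddResidue j                            ∎
        where open ≡-Reasoning

  private
    bounds : ∀ {i j} → suc (suc (i ℕ.+ j)) ≤ p → i < p × j < p
    bounds {i} {j} bound = ℕP.<-≤-trans (s≤s (ℕP.m≤m+n i j)) (ℕP.≤-trans (ℕP.n≤1+n _) bound)
                         , ℕP.<-≤-trans (s≤s (ℕP.m≤n+m j i)) (ℕP.≤-trans (ℕP.n≤1+n _) bound)

    -- The four indices would sum to 2p − 2, while admissibility bounds them by 2p − 4.
    ¬complementary : ∀ {a b c d} → suc (suc (a ℕ.+ b)) ≤ p → suc (suc (c ℕ.+ d)) ≤ p →
                     suc (b ℕ.+ d) ≡ p → suc (a ℕ.+ c) ≡ p → ⊥
    ¬complementary {a} {b} {c} {d} ab cd bd≡p ac≡p = ℕP.<-irrefl refl (ℕP.<-≤-trans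
      (ℕP.≤-trans (s≤s (ℕP.n≤1+n _)) (ℕP.≤-reflexive (sym (regroup a b c d))))
      (ℕP.≤-trans (ℕP.+-mono-≤ ab cd) (ℕP.≤-reflexive (sym (cong₂ ℕ._+_ bd≡p ac≡p)))))
      where
        regroup : ∀ a b c d → suc (suc (a ℕ.+ b)) ℕ.+ suc (suc (c ℕ.+ d)) ≡ suc (suc (suc (b ℕ.+ d) ℕ.+ suc (a ℕ.+ c)))
        regroup = ℕSolver.solve-∀

  representative-injective : ∀ x y adm adm' → Equiv (representative x adm) (representative y adm') → x ≡ y
  representative-injective (i , j) (i' , j') adm@(i<j , bound) adm'@(i'<j' , bound') eqv =
    from-steps (Zigzag-shift⇒steps (oddResidue-odd j) (oddResidue-odd i) (oddResidue-odd j') (oddResidue-odd i') j≉i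
                  (proj₂ (Equiv⇒Zigzag-shift {representative _ adm} {representative _ adm'} (representative-isZigzag _ adm) (representative-isZigzag _ adm') eqv)))
    where
      i<p : i < p
      i<p = proj₁ (bounds bound)
      j<p : j < p
      j<p = proj₂ (bounds bound)
      i'<p : i' < p
      i'<p = proj₁ (bounds bound')
      j'<p : j' < p
      j'<p = proj₂ (bounds bound')
      j≉i : ¬ (oddResidue j ≈ oddResidue i)
      j≉i j≈i = ℕP.<-irrefl (sym (oddResidue-injective j<p i<p j≈i)) i<j
      from-steps : SameSteps (oddResidue j) (oddResidue i) (oddResidue j') (oddResidue i') ⊎
                   SameSteps (oddResidue j) (oddResidue i) (- oddResidue j') (- oddResidue i') → (i , j) ≡ (i' , j')
      from-steps (inj₁ (inj₁ (j≈j' , i≈i'))) = cong₂ _,_ (oddResidue-injective i<p i'<p i≈i') (oddResidue-injective j<p j'<p j≈j')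
      from-steps (inj₁ (inj₂ (j≈i' , i≈j'))) = ⊥-elim (ℕP.<-asym (subst₂ _<_ (sym (oddResidue-injective j<p i'<p j≈i')) (sym (oddResidue-injective i<p j'<p i≈j')) i'<j') i<j)
      from-steps (inj₂ (inj₁ (j≈-j' , i≈-i'))) = ⊥-elim (¬complementary {i} {j} {i'} {j'} bound bound'
        (oddResidue-sum≈0 j<p j'<p (≈neg⇒+≈0 j≈-j')) (oddResidue-sum≈0 i<p i'<p (≈neg⇒+≈0 i≈-i')))
      from-steps (inj₂ (inj₂ (j≈-i' , i≈-j'))) = ⊥-elim (¬complementary {i} {j} {j'} {i'} bound (subst (λ n → suc (suc n) ≤ p) (ℕP.+-comm i' j') bound')
        (oddResidue-sum≈0 j<p i'<p (≈neg⇒+≈0 j≈-i')) (oddResidue-sum≈0 i<p j'<p (≈neg⇒+≈0 i≈-j')))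

  private
    Class : ℤ → ℤ → Set
    Class b c = ∃ λ x → Admissible x × ((adm : Admissible x) → SameSteps b c (oddResidue (proj₂ x)) (oddResidue (proj₁ x)))

    class : ∀ {b c m n} → m < p → n < p → b ≈ oddResidue m → c ≈ oddResidue n → ¬ (b ≈ c) →
            suc (suc (m ℕ.+ n)) ≤ p → Class b c
    class {b} {c} {m} {n} m<p n<p b≈ c≈ b≉c bound = order (ℕP.<-cmp m n)
      where
        order : Tri (m < n) (m ≡ n) (n < m) → Class b c
        order (tri< m<n _ _) = (m , n) , (m<n , bound) , λ _ → inj₂ (b≈ , c≈)
        order (tri≈ _ refl _) = ⊥-elim (b≉c (≈-trans b≈ (≈-sym c≈)))
        order (tri> _ _ n<m) = (n , m) , (n<m , subst (λ s → suc (suc s) ≤ p) (ℕP.+-comm m n) bound) , λ _ → inj₁ (b≈ , c≈)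

    complement : ℕ → ℕ
    complement m = (2 ℕ.+ k) ℕ.∸ m

    complement<p : ∀ m → complement m < p
    complement<p m = s≤s (ℕP.m∸n≤m (2 ℕ.+ k) m)

    complement-bound : ∀ {m n} → m < p → n < p → p < suc (m ℕ.+ n) → suc (suc (complement m ℕ.+ complement n)) ≤ p
    complement-bound {m} {n} m<p n<p p<m+n+1 = ℕP.+-cancelʳ-≤ p _ p (begin
      suc (suc (m' ℕ.+ n')) ℕ.+ p              ≤⟨ ℕP.+-monoʳ-≤ (suc (suc (m' ℕ.+ n'))) (ℕP.≤-pred p<m+n+1) ⟩
      suc (suc (m' ℕ.+ n')) ℕ.+ (m ℕ.+ n)      ≡⟨ regroup m n m' n' ⟩
      suc (suc ((m ℕ.+ m') ℕ.+ (n ℕ.+ n')))    ≡⟨ cong₂ (λ a b → suc (suc (a ℕ.+ b))) (ℕP.m+[n∸m]≡n (ℕP.≤-pred m<p)) (ℕP.m+[n∸m]≡n (ℕP.≤-pred n<p)) ⟩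
      suc (suc ((2 ℕ.+ k) ℕ.+ (2 ℕ.+ k)))      ≡⟨ shape k ⟩
      p ℕ.+ p                                  ∎)
      where
        open ℕP.≤-Reasoning
        m' n' : ℕ
        m' = complement m
        n' = complement n
        regroup : ∀ m n a b → suc (suc (a ℕ.+ b)) ℕ.+ (m ℕ.+ n) ≡ suc (suc ((m ℕ.+ a) ℕ.+ (n ℕ.+ b)))
        regroup = ℕSolver.solve-∀
        shape : ∀ k → suc (suc ((2 ℕ.+ k) ℕ.+ (2 ℕ.+ k))) ≡ (3 ℕ.+ k) ℕ.+ (3 ℕ.+ k)
        shape = ℕSolver.solve-∀

  Represented : Ordering N → Set
  Represented P = ∃ λ x → Admissible x × ((adm : Admissible x) → Equiv P (representative x adm))

  representative-complete : ∀ P → HasAxes p P → Represented P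
  representative-complete P H = fromResidues (odd⇒oddResidue b-odd) (odd⇒oddResidue c-odd)
    where
      p-odd : Odd (+ p)
      p-odd = prime-odd pr (λ ())
      form : ZigzagForm (proj₁ P)
      form = Structure.zigzagForm k p-odd P (PrimeSymmetries.Rotation-2 k pr P H) (PrimeSymmetries.¬Rotation-1 k pr P H)
      open ZigzagForm form
      fromResidues : (∃ λ m → m < p × b ≈ oddResidue m) → (∃ λ n → n < p × c ≈ oddResidue n) → Represented P
      fromResidues (m , m<p , b≈) (n , n<p , c≈) = bySum (ℕP.<-cmp (suc (m ℕ.+ n)) p)
        where
          direct : Class b c → Represented P
          direct (x , adm , s) = x , adm , λ adm' → SameSteps⇒Equiv {P} {representative x adm'} isZigzag (representative-isZigzag x adm') (s adm')
          opposite : Class (- b) (- c) → Represented P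
          opposite (x , adm , s) = x , adm , λ adm' → OppositeSteps⇒Equiv {P} {representative x adm'} b-odd c-odd isZigzag (representative-isZigzag x adm') (s adm')
          bySum : Tri (suc (m ℕ.+ n) < p) (suc (m ℕ.+ n) ≡ p) (p < suc (m ℕ.+ n)) → Represented P
          bySum (tri< small _ _) = direct (class m<p n<p b≈ c≈ b≉c small)
          bySum (tri≈ _ s≡p _) = ⊥-elim (b+c≉0 (≈-trans (+-cong b≈ c≈) (oddResidue-sum-p s≡p)))
          bySum (tri> _ _ large) = opposite (class (complement<p m) (complement<p n)
            (≈-trans (neg-cong b≈) (neg-oddResidue m<p)) (≈-trans (neg-cong c≈) (neg-oddResidue n<p))
            (λ -b≈-c → b≉c (≈-trans (≈-reflexive (sym (ℤP.neg-involutive b))) (≈-trans (neg-cong -b≈-c) (≈-reflexive (ℤP.neg-involutive c)))))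
            (complement-bound m<p n<p large))

rowEntry : ℕ → ℕ → ℕ × ℕ
rowEntry i₀ d = i₀ , suc i₀ ℕ.+ d

row : ℕ → ℕ → List (ℕ × ℕ)
row i₀ m = applyUpTo (rowEntry i₀) (suc (double m))

-- pairs m i₀ lists the (i , j) with i₀ ≤ i < j and i + j < 2 (i₀ + m), row by row in i.
pairs : ℕ → ℕ → List (ℕ × ℕ)
pairs zero i₀ = []
pairs (suc m) i₀ = row i₀ m ++ pairs m (suc i₀)

pairs-length : ∀ m i₀ → length (pairs m i₀) ≡ m ℕ.* m
pairs-length zero i₀ = refl
pairs-length (suc m) i₀ = begin
  length (row i₀ m ++ pairs m (suc i₀))            ≡⟨ ListP.length-++ (row i₀ m) ⟩
  length (row i₀ m) ℕ.+ length (pairs m (suc i₀))  ≡⟨ cong₂ ℕ._+_ (ListP.length-applyUpTo (rowEntry i₀) (suc (double m))) (pairs-length m (suc i₀)) ⟩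
  suc (double m) ℕ.+ m ℕ.* m                       ≡⟨ cong (λ z → suc z ℕ.+ m ℕ.* m) (double≡+ m) ⟩
  suc (m ℕ.+ m) ℕ.+ m ℕ.* m                        ≡⟨ square m ⟩
  suc m ℕ.* suc m                                  ∎
  where
    open ≡-Reasoning
    square : ∀ m → suc (m ℕ.+ m) ℕ.+ m ℕ.* m ≡ suc m ℕ.* suc m
    square = ℕSolver.solve-∀

InRange : ℕ → ℕ → ℕ × ℕ → Set
InRange i₀ m (i , j) = i₀ ≤ i × i < j × i ℕ.+ j < double (i₀ ℕ.+ m)

private
  double-+-suc : ∀ i m → double (i ℕ.+ suc m) ≡ suc i ℕ.+ (suc i ℕ.+ double m)
  double-+-suc i m = trans (double≡+ (i ℕ.+ suc m)) (trans (shape i m) (cong (λ z → suc i ℕ.+ (suc i ℕ.+ z)) (sym (double≡+ m))))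
    where
      shape : ∀ i m → i ℕ.+ suc m ℕ.+ (i ℕ.+ suc m) ≡ suc i ℕ.+ (suc i ℕ.+ (m ℕ.+ m))
      shape = ℕSolver.solve-∀

pairs-sound : ∀ m i₀ → All (InRange i₀ m) (pairs m i₀)
pairs-sound zero i₀ = All.[]
pairs-sound (suc m) i₀ = AllP.++⁺ (AllP.applyUpTo⁺₁ (rowEntry i₀) (suc (double m)) in-row) (ListAll.map weaken (pairs-sound m (suc i₀)))
  where
    in-row : ∀ {d} → d < suc (double m) → InRange i₀ (suc m) (i₀ , suc i₀ ℕ.+ d)
    in-row {d} (s≤s d≤2m) = ℕP.≤-refl , s≤s (ℕP.m≤m+n i₀ d) ,
      subst (i₀ ℕ.+ (suc i₀ ℕ.+ d) <_) (sym (double-+-suc i₀ m)) (s≤s (ℕP.+-monoʳ-≤ i₀ (ℕP.+-monoʳ-≤ (suc i₀) d≤2m)))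
    weaken : ∀ {x} → InRange (suc i₀) m x → InRange i₀ (suc m) x
    weaken {i , j} (i₀<i , i<j , bound) = ℕP.<⇒≤ i₀<i , i<j , subst (λ z → i ℕ.+ j < double z) (sym (ℕP.+-suc i₀ m)) bound

pairs-complete : ∀ m i₀ {x} → InRange i₀ m x → x ∈ pairs m i₀
pairs-complete zero i₀ {i , j} (i₀≤i , i<j , bound) = ⊥-elim (ℕP.<-irrefl refl (ℕP.<-≤-trans bound
  (subst (_≤ i ℕ.+ j) (sym (trans (cong double (ℕP.+-identityʳ i₀)) (double≡+ i₀))) (ℕP.+-mono-≤ i₀≤i (ℕP.≤-trans i₀≤i (ℕP.<⇒≤ i<j))))))
pairs-complete (suc m) i₀ {i , j} (i₀≤i , i<j , bound) with ℕP.m≤n⇒m<n∨m≡n i₀≤i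
... | inj₁ i₀<i = MembershipP.∈-++⁺ʳ (row i₀ m) (pairs-complete m (suc i₀) (i₀<i , i<j , subst (λ z → i ℕ.+ j < double z) (ℕP.+-suc i₀ m) bound))
... | inj₂ refl = MembershipP.∈-++⁺ˡ (subst (_∈ row i₀ m) (cong (i₀ ,_) (ℕP.m+[n∸m]≡n i<j)) (MembershipP.∈-applyUpTo⁺ (rowEntry i₀) d<))
  where
    d : ℕ
    d = j ℕ.∸ suc i₀
    j≤ : j ≤ suc i₀ ℕ.+ double m
    j≤ = ℕP.+-cancelˡ-≤ (suc i₀) j (suc i₀ ℕ.+ double m) (subst (suc (i₀ ℕ.+ j) ≤_) (double-+-suc i₀ m) bound)
    d< : d < suc (double m)
    d< = s≤s (ℕP.+-cancelˡ-≤ (suc i₀) d (double m) (subst (_≤ suc i₀ ℕ.+ double m) (sym (ℕP.m+[n∸m]≡n i<j)) j≤))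

pairs-unique : ∀ m i₀ → AllPairs (λ x y → ¬ x ≡ y) (pairs m i₀)
pairs-unique zero i₀ = AllPairs.[]
pairs-unique (suc m) i₀ = AllPairsP.++⁺ row-unique (pairs-unique m (suc i₀)) (AllP.applyUpTo⁺₁ (rowEntry i₀) (suc (double m)) row∉rest)
  where
    row-unique : AllPairs (λ x y → ¬ x ≡ y) (row i₀ m)
    row-unique = AllPairsP.applyUpTo⁺₁ (rowEntry i₀) (suc (double m))
      (λ {a} {b} a<b _ eq → ℕP.<-irrefl (ℕP.+-cancelˡ-≡ (suc i₀) a b (cong proj₂ eq)) a<b)
    row∉rest : ∀ {d} → d < suc (double m) → All (λ y → ¬ rowEntry i₀ d ≡ y) (pairs m (suc i₀))
    row∉rest _ = ListAll.map (λ i₀<i eq → ℕP.<-irrefl (cong proj₁ eq) (proj₁ i₀<i)) (pairs-sound m (suc i₀))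

module Counting (k : ℕ) (pr : Prime (3 ℕ.+ k)) where
  open All using ([]; _∷_)
  open AllPairs using ([]; _∷_)
  open Family k pr
  open Classes k using (N; p)

  representatives : (xs : List (ℕ × ℕ)) → All Admissible xs → List (Ordering N)
  representatives [] [] = []
  representatives (x ∷ xs) (adm ∷ adms) = representative x adm ∷ representatives xs adms

  representatives-length : ∀ xs adms → length (representatives xs adms) ≡ length xs
  representatives-length [] [] = refl
  representatives-length (x ∷ xs) (adm ∷ adms) = cong suc (representatives-length xs adms)

  representatives-hasAxes : ∀ xs adms → All (HasAxes p) (representatives xs adms)
  representatives-hasAxes [] [] = []
  representatives-hasAxes (x ∷ xs) (adm ∷ adms) = representative-hasAxes x adm ∷ representatives-hasAxes xs adms

  representatives-inequivalent : ∀ xs adms → AllPairs (λ x y → ¬ x ≡ y) xs → AllPairs (λ P Q → ¬ Equiv P Q) (representatives xs adms)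
  representatives-inequivalent [] [] [] = []
  representatives-inequivalent (x ∷ xs) (adm ∷ adms) (x∉ ∷ distinct) = head-inequivalent xs adms x∉ ∷ representatives-inequivalent xs adms distinct
    where
      head-inequivalent : ∀ ys adms′ → All (λ y → ¬ x ≡ y) ys → All (λ Q → ¬ Equiv (representative x adm) Q) (representatives ys adms′)
      head-inequivalent [] [] [] = []
      head-inequivalent (y ∷ ys) (adm′ ∷ adms′) (x≢y ∷ x∉ys) =
        (x≢y ∘ representative-injective x y adm adm′) ∷ head-inequivalent ys adms′ x∉ys

  representatives-any : ∀ {R : Ordering N → Set} xs adms {x} → x ∈ xs → (∀ adm → R (representative x adm)) → Any R (representatives xs adms)
  representatives-any (y ∷ xs) (adm ∷ adms) (here refl) R-x = here (R-x adm)
  representatives-any (y ∷ xs) (adm ∷ adms) (there x∈) R-x = there (representatives-any xs adms x∈ R-x)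

  module _ (q : ℕ) (p≡2q+1 : p ≡ suc (double q)) where

    private
      InRange⇒Admissible : ∀ {x} → InRange 0 q x → Admissible x
      InRange⇒Admissible {i , j} (_ , i<j , bound) = i<j , subst (suc (suc (i ℕ.+ j)) ≤_) (sym p≡2q+1) (s≤s bound)

      Admissible⇒InRange : ∀ {x} → Admissible x → InRange 0 q x
      Admissible⇒InRange {i , j} (i<j , bound) = z≤n , i<j , ℕP.≤-pred (subst (suc (suc (i ℕ.+ j)) ≤_) p≡2q+1 bound)

      admissible : All Admissible (pairs q 0)
      admissible = ListAll.map InRange⇒Admissible (pairs-sound q 0)

    numClasses : NumClasses N p (q ℕ.* q)
    numClasses = representatives (pairs q 0) admissible
               , trans (representatives-length (pairs q 0) admissible) (pairs-length q 0)
               , representatives-hasAxes (pairs q 0) admissible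
               , representatives-inequivalent (pairs q 0) admissible (pairs-unique q 0)
               , λ P H → complete P (representative-complete P H)
      where
        complete : ∀ P → Represented P → Any (Equiv P) (representatives (pairs q 0) admissible)
        complete P (x , adm , P≃) = representatives-any (pairs q 0) admissible (pairs-complete q 0 (Admissible⇒InRange adm)) P≃

classCount : ∀ q → ((2 ℕ.* suc (double q) ℕ.∸ 2) ℕ./ 4) ℕ.^ 2 ≡ q ℕ.* q
classCount q = begin
  ((2 ℕ.* suc (double q) ℕ.∸ 2) ℕ./ 4) ℕ.^ 2    ≡⟨ cong (λ n → ((n ℕ.∸ 2) ℕ./ 4) ℕ.^ 2) (shape q) ⟩
  ((2 ℕ.+ q ℕ.* 4 ℕ.∸ 2) ℕ./ 4) ℕ.^ 2           ≡⟨ cong (λ n → (n ℕ./ 4) ℕ.^ 2) (ℕP.m+n∸m≡n 2 (q ℕ.* 4)) ⟩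
  ((q ℕ.* 4) ℕ./ 4) ℕ.^ 2                       ≡⟨ cong (ℕ._^ 2) (ℕD.m*n/n≡m q 4) ⟩
  q ℕ.^ 2                                       ≡⟨ cong (q ℕ.*_) (ℕP.*-identityʳ q) ⟩
  q ℕ.* q                                       ∎
  where
    open ≡-Reasoning
    shape : ∀ q → 2 ℕ.* suc (double q) ≡ 2 ℕ.+ q ℕ.* 4
    shape q = trans (cong (λ n → 2 ℕ.* suc n) (double≡+ q)) (expand q)
      where
        expand : ∀ q → 2 ℕ.* suc (q ℕ.+ q) ≡ 2 ℕ.+ q ℕ.* 4
        expand = ℕSolver.solve-∀

mainTheorem4 : (p : ℕ) → Prime p → 2 < p → NumClasses (2 ℕ.* p) p (((2 ℕ.* p ℕ.∸ 2) ℕ./ 4) ℕ.^ 2)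
mainTheorem4 (suc (suc (suc k))) pr (s≤s (s≤s (s≤s _))) = count (odd⇒suc-double (prime-odd pr λ ()))
  where
    p : ℕ
    p = 3 ℕ.+ k
    count : (∃ λ q → p ≡ suc (double q)) → NumClasses (2 ℕ.* p) p (((2 ℕ.* p ℕ.∸ 2) ℕ./ 4) ℕ.^ 2)
    count (q , p≡2q+1) = subst (NumClasses (2 ℕ.* p) p) (sym count≡q²) (Counting.numClasses k pr q p≡2q+1)
      where
        count≡q² : ((2 ℕ.* p ℕ.∸ 2) ℕ./ 4) ℕ.^ 2 ≡ q ℕ.* q
        count≡q² = trans (cong (λ n → ((2 ℕ.* n ℕ.∸ 2) ℕ./ 4) ℕ.^ 2) p≡2q+1) (classCount q)
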